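{- Let $n\in\mathbb{N}$, $\varkappa\in\mathbb{N}^n$, $N\coloneqq\varkappa_1+\cdots+\varkappa_n$, $m\in\mathbb{N}_0$, and let $y_1,\ldots,y_n$ be independent variables or pairwise different numbers. Then \[ \operatorname{h}_m(y^{[\varkappa]})=\frac{\det G_{(m)}(y,\varkappa)}{\det G_{\emptyset}(y,\varkappa)}. \]
   Context: $\operatorname{h}_m(x_1,\ldots,x_N)=\sum_{k\in\mathbb{N}_0^N,\,k_1+\cdots+k_N=m}x_1^{k_1}\cdots x_N^{k_N}$ is the complete homogeneous symmetric polynomial of degree $m$. For $y=(y_1,\ldots,y_n)$ and $\varkappa\in\mathbb{N}^n$, $y^{[\varkappa]}$ denotes the list of length $N$ in which $y_1$ is repeated $\varkappa_1$ times, then $y_2$ repeated $\varkappa_2$ times, etc. Let $\sigma_0\coloneqq0$, $\sigma_p\coloneqq\varkappa_1+\cdots+\varkappa_p$; for $p\in\{1,\ldots,N\}$ let $q\in\{1,\ldots,n\}$ be the unique index with $\sigma_{q-1}<p\le\sigma_q$ and $r\coloneqq p-\sigma_{q-1}$. For a partition $\lambda$ of length $\le N$ (with $\lambda_j\coloneqq0$ beyond its length), $G_\lambda(y,\varkappa)$ is the $N\times N$ matrix with $(j,p)$ entry $\binom{N+\lambda_j-j}{r-1}y_q^{N+\lambda_j-j-r+1}$ if $N+\lambda_j-j-r+1\ge0$ and $0$ otherwise. Here $(m)$ is the one-part partition (the empty partition if $m=0$) and $\emptyset$ is the empty partition. For variables the identity holds in the field of rational functions. -}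

module Defs where

open import Level using (_⊔_)
import Algebra.Bundles
open import Algebra.Bundles using (CommutativeRing)
open import Data.Nat as ℕ using (ℕ; zero; suc; _≤_; _≤?_)
open import Data.Nat.Combinatorics using (_C_)
open import Data.Fin as Fin using (Fin; toℕ; punchIn)
open import Data.List as List using (List; []; _∷_; upTo; concatMap)
open import Data.Vec as Vec using (Vec; []; _∷_; _++_; replicate; lookup; tabulate)
open import Relation.Nullary using (¬_; yes; no)

record Field (c ℓ : Level.Level) : Set (Level.suc (c ⊔ ℓ)) where
  field
    commutativeRing : CommutativeRing c ℓ
  open CommutativeRing commutativeRing public
  field
    0≉1      : ¬ (0# ≈ 1#)
    inverse  : (x : Carrier) → ¬ (x ≈ 0#) → Carrier
    inverseʳ : (x : Carrier) (nz : ¬ (x ≈ 0#)) → x * inverse x nz ≈ 1#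

-- Partitions are represented as lists of parts; λ_j (1-indexed) with default 0.
partPart : List ℕ → ℕ → ℕ
partPart []       _             = 0
partPart (x ∷ xs) zero          = 0
partPart (x ∷ xs) (suc zero)    = x
partPart (x ∷ xs) (suc (suc j)) = partPart xs (suc j)

onePart : ℕ → List ℕ
onePart zero    = []
onePart (suc k) = suc k ∷ []

emptyPart : List ℕ
emptyPart = []

compositions : ℕ → (N : ℕ) → List (Vec ℕ N)
compositions zero    zero    = [] ∷ []
compositions (suc m) zero    = []
compositions m       (suc N) =
  concatMap (λ k → List.map (k ∷_) (compositions (m ℕ.∸ k) N)) (upTo (suc m))

module _ {c ℓ} (R : CommutativeRing c ℓ) where
  open CommutativeRing R
  open import Algebra.Definitions.RawSemiring (Algebra.Bundles.Semiring.rawSemiring semiring) using (_^_; _×_)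

  sumList : List Carrier → Carrier
  sumList = List.foldr _+_ 0#

  prodVec : ∀ {k} → Vec Carrier k → Carrier
  prodVec = Vec.foldr _ _*_ 1#

  sumFin : ∀ k → (Fin k → Carrier) → Carrier
  sumFin zero    f = 0#
  sumFin (suc k) f = f Fin.zero + sumFin k (λ i → f (Fin.suc i))

  signed : ℕ → Carrier → Carrier
  signed zero    x = x
  signed (suc i) x = - signed i x

  det : ∀ k → (Fin k → Fin k → Carrier) → Carrier
  det zero    M = 1#
  det (suc k) M =
    sumFin (suc k) (λ p → signed (toℕ p)
      (M Fin.zero p * det k (λ i l → M (Fin.suc i) (punchIn p l))))

  hcomplete : ∀ {N} → ℕ → Vec Carrier N → Carrier
  hcomplete {N} m x =
    sumList (List.map (λ k → prodVec (Vec.zipWith _^_ x k)) (compositions m N))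

  expand : ∀ {n} → Vec Carrier n → (κ : Vec ℕ n) → Vec Carrier (Vec.sum κ)
  expand []       []       = []
  expand (y ∷ ys) (k ∷ ks) = replicate k y ++ expand ys ks

  -- entry (j,p) of G_λ, with column p corresponding to (q, r), r0 = r - 1,
  -- and j0 = j - 1.
  Gentry : (N : ℕ) → List ℕ → Carrier → ℕ → ℕ → Carrier
  Gentry N lam yq r0 j0 with r0 ≤? (N ℕ.+ partPart lam (suc j0) ℕ.∸ suc j0)
  ... | yes _ = ((N ℕ.+ partPart lam (suc j0) ℕ.∸ suc j0) C r0)
                  × (yq ^ (N ℕ.+ partPart lam (suc j0) ℕ.∸ suc j0 ℕ.∸ r0))
  ... | no  _ = 0#

  Gcols : (N : ℕ) → List ℕ → ∀ {n} → Vec Carrier n → (κ : Vec ℕ n)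
        → Vec (Fin N → Carrier) (Vec.sum κ)
  Gcols N lam []       []       = []
  Gcols N lam (y ∷ ys) (k ∷ ks) =
    tabulate {k} (λ r j → Gentry N lam y (toℕ r) (toℕ j)) ++ Gcols N lam ys ks

  G : List ℕ → ∀ {n} → Vec Carrier n → (κ : Vec ℕ n)
    → Fin (Vec.sum κ) → Fin (Vec.sum κ) → Carrier
  G lam y κ j p = lookup (Gcols (Vec.sum κ) lam y κ) p j

-- Column (q, r) of G_λ(y, κ) applies f ↦ f⁽ʳ⁻¹⁾(y_q)/(r−1)! to the monomials x^(N+λ_j−j) labelling
-- the rows. Let z = y^[κ] and P_i = (x − z_1)⋯(x − z_i). Since x^e = Σ_{i≤e} h_{e−i}(z_1,…,z_{i+1}) P_i,
-- replacing each monomial row of G_∅ by the row of the corresponding P_e is a unitriangular row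
-- operation, and the resulting matrix is anti-triangular: counting columns from 0, column t kills P_i
-- for i > t, whose root at its node has multiplicity above the derivative order, but not P_t, whose
-- multiplicity there equals that order and whose other roots are different nodes. Hence det G_∅ ≠ 0.
-- In G_(m) only the top row changes, to x^(N−1+m); modulo the lower rows it reduces to
-- h_m(z_1,…,z_N) P_(N−1), so det G_(m) = h_m(z) · det G_∅.

{-# OPTIONS --safe #-}
module Submission where

open import Defs
open import Data.Nat using (ℕ; _≤_)
open import Data.Fin using (Fin)
open import Data.Vec using (Vec; lookup; sum)
open import Data.Product using (Σ)
open import Relation.Nullary using (¬_)
open import Relation.Binary.PropositionalEquality using (_≢_)

open import Level using (Lift; lift) renaming (_⊔_ to _⊔ˡ_)
import Algebra.Bundles
open import Algebra.Bundles using (CommutativeRing)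
open import Data.Nat using (zero; suc)
import Data.Nat as ℕ
import Data.Nat.Properties as ℕₚ
open import Data.Fin using (zero; suc; toℕ; punchIn; fromℕ; fromℕ<; inject₁)
import Data.Fin as Fin
import Data.Fin.Properties as Finₚ
import Data.Vec as Vec
open import Data.List using (List)
open import Data.Product using (_,_; proj₁; proj₂)
open import Data.Sum using (_⊎_; inj₁; inj₂)
open import Data.Unit using (⊤)
open import Data.Empty using (⊥-elim)
open import Function using (_∘_; id)
import Relation.Binary.PropositionalEquality as ≡
open ≡ using (_≡_)

module RangeSum {c ℓ} (R : CommutativeRing c ℓ) where
  open CommutativeRing R hiding (zero)
  open import Algebra.Properties.Semiring.Sum semiring using (sum-syntax)
  open import Algebra.Solver.Ring.NaturalCoefficients.Default commutativeSemiring

  sumUpTo : ℕ → (ℕ → Carrier) → Carrier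
  sumUpTo zero    f = 0#
  sumUpTo (suc n) f = f 0 + sumUpTo n (f ∘ suc)

  sumUpTo-cong : ∀ n {f g : ℕ → Carrier} → (∀ i → i ℕ.< n → f i ≈ g i) → sumUpTo n f ≈ sumUpTo n g
  sumUpTo-cong zero    f≈g = refl
  sumUpTo-cong (suc n) f≈g =
    +-cong (f≈g 0 (ℕ.s≤s ℕ.z≤n)) (sumUpTo-cong n (λ i i<n → f≈g (suc i) (ℕ.s≤s i<n)))

  sumUpTo-zero : ∀ n {f : ℕ → Carrier} → (∀ i → i ℕ.< n → f i ≈ 0#) → sumUpTo n f ≈ 0#
  sumUpTo-zero zero    f≈0 = refl
  sumUpTo-zero (suc n) f≈0 =
    trans (+-cong (f≈0 0 (ℕ.s≤s ℕ.z≤n)) (sumUpTo-zero n (λ i i<n → f≈0 (suc i) (ℕ.s≤s i<n))))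
          (+-identityˡ 0#)

  sumUpTo-distrib-+ : ∀ n (f g : ℕ → Carrier) → sumUpTo n (λ i → f i + g i) ≈ sumUpTo n f + sumUpTo n g
  sumUpTo-distrib-+ zero    f g = sym (+-identityˡ 0#)
  sumUpTo-distrib-+ (suc n) f g = trans (+-congˡ (sumUpTo-distrib-+ n (f ∘ suc) (g ∘ suc)))
    (solve 4 (λ a b c d → a :+ b :+ (c :+ d) := (a :+ c) :+ (b :+ d)) refl (f 0) (g 0) _ _)

  *-distribˡ-sumUpTo : ∀ n a (f : ℕ → Carrier) → a * sumUpTo n f ≈ sumUpTo n (λ i → a * f i)
  *-distribˡ-sumUpTo zero    a f = zeroʳ a
  *-distribˡ-sumUpTo (suc n) a f = trans (distribˡ a _ _) (+-congˡ (*-distribˡ-sumUpTo n a (f ∘ suc)))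

  sumUpTo-suc : ∀ n (f : ℕ → Carrier) → sumUpTo (suc n) f ≈ sumUpTo n f + f n
  sumUpTo-suc zero    f = trans (+-identityʳ (f 0)) (sym (+-identityˡ (f 0)))
  sumUpTo-suc (suc n) f = trans (+-congˡ (sumUpTo-suc n (f ∘ suc))) (sym (+-assoc (f 0) _ _))

  sumUpTo-split : ∀ a b (f : ℕ → Carrier) → sumUpTo (a ℕ.+ b) f ≈ sumUpTo a f + sumUpTo b (λ i → f (a ℕ.+ i))
  sumUpTo-split zero    b f = sym (+-identityˡ _)
  sumUpTo-split (suc a) b f = trans (+-congˡ (sumUpTo-split a b (f ∘ suc))) (sym (+-assoc (f 0) _ _))

  sumUpTo-reverse : ∀ n (f : ℕ → Carrier) → sumUpTo n f ≈ ∑[ j < n ] f (n ℕ.∸ suc (toℕ j))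
  sumUpTo-reverse zero    f = refl
  sumUpTo-reverse (suc n) f = trans (sumUpTo-suc n f) (trans (+-comm _ _) (+-congˡ (sumUpTo-reverse n f)))

module PowerTaylor {c ℓ} (R : CommutativeRing c ℓ) where
  open CommutativeRing R hiding (zero)
  open import Algebra.Definitions.RawSemiring (Algebra.Bundles.Semiring.rawSemiring semiring) using (_^_; _×_)
  open import Algebra.Properties.Semiring.Mult semiring using (×-homo-+; ×-comm-*; ×-homo-1)
  open import Data.Nat.Combinatorics using (_C_; nCn≡1; nCk+nC[k+1]≡[n+1]C[k+1])
  open import Relation.Nullary using (Dec; yes; no)
  open import Relation.Binary.Reasoning.Setoid setoid

  -- the coefficient of (x − ζ)^r in x^e
  powerTaylor : ℕ → Carrier → ℕ → Carrier
  powerTaylor e ζ r with r ℕ.≤? e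
  ... | yes _ = (e C r) × (ζ ^ (e ℕ.∸ r))
  ... | no  _ = 0#

  powerTaylor-≤ : ∀ e ζ r → r ≤ e → powerTaylor e ζ r ≡ (e C r) × (ζ ^ (e ℕ.∸ r))
  powerTaylor-≤ e ζ r r≤e with r ℕ.≤? e
  ... | yes _   = ≡.refl
  ... | no  r≰e = ⊥-elim (r≰e r≤e)

  powerTaylor-> : ∀ e ζ r → ¬ r ≤ e → powerTaylor e ζ r ≡ 0#
  powerTaylor-> e ζ r r≰e with r ℕ.≤? e
  ... | yes r≤e = ⊥-elim (r≰e r≤e)
  ... | no  _   = ≡.refl

  Gentry≡powerTaylor : ∀ N lam ζ r j →
    Gentry R N lam ζ r j ≡ powerTaylor (N ℕ.+ partPart lam (suc j) ℕ.∸ suc j) ζ r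
  Gentry≡powerTaylor N lam ζ r j with r ℕ.≤? (N ℕ.+ partPart lam (suc j) ℕ.∸ suc j)
  ... | yes _ = ≡.refl
  ... | no  _ = ≡.refl

  -- turns the Taylor coefficients at ζ of f into those of (x − ζ) · f
  previous : (ℕ → Carrier) → ℕ → Carrier
  previous f zero    = 0#
  previous f (suc r) = f r

  powerTaylor-suc : ∀ e ζ r → powerTaylor (suc e) ζ r ≈ ζ * powerTaylor e ζ r + previous (powerTaylor e ζ) r
  powerTaylor-suc e ζ zero = begin
    powerTaylor (suc e) ζ 0       ≈⟨ reflexive (powerTaylor-≤ (suc e) ζ 0 ℕ.z≤n) ⟩
    1 × (ζ * ζ ^ e)               ≈⟨ ×-homo-1 _ ⟩
    ζ * ζ ^ e                     ≈⟨ *-congˡ (×-homo-1 (ζ ^ e)) ⟨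
    ζ * (1 × ζ ^ e)               ≈⟨ *-congˡ (reflexive (powerTaylor-≤ e ζ 0 ℕ.z≤n)) ⟨
    ζ * powerTaylor e ζ 0         ≈⟨ +-identityʳ _ ⟨
    ζ * powerTaylor e ζ 0 + 0#    ∎
  powerTaylor-suc e ζ (suc r) = by-cases e (suc r ℕ.≤? e) (r ℕ.≤? e)
    where
    by-cases : ∀ e → Dec (suc r ≤ e) → Dec (r ≤ e) →
      powerTaylor (suc e) ζ (suc r) ≈ ζ * powerTaylor e ζ (suc r) + powerTaylor e ζ r
    by-cases e (yes r<e) _ = begin
      powerTaylor (suc e) ζ (suc r)
        ≈⟨ reflexive (powerTaylor-≤ (suc e) ζ (suc r) (ℕ.s≤s (ℕₚ.<⇒≤ r<e))) ⟩
      (suc e C suc r) × (ζ ^ (e ℕ.∸ r))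
        ≈⟨ reflexive (≡.cong₂ _×_ (≡.sym (nCk+nC[k+1]≡[n+1]C[k+1] e r)) (≡.cong (ζ ^_) e∸r≡1+e∸1+r)) ⟩
      (e C r ℕ.+ e C suc r) × (ζ * ζ ^ (e ℕ.∸ suc r))
        ≈⟨ ×-homo-+ _ (e C r) (e C suc r) ⟩
      (e C r) × (ζ * ζ ^ (e ℕ.∸ suc r)) + (e C suc r) × (ζ * ζ ^ (e ℕ.∸ suc r))
        ≈⟨ +-comm _ _ ⟩
      (e C suc r) × (ζ * ζ ^ (e ℕ.∸ suc r)) + (e C r) × (ζ * ζ ^ (e ℕ.∸ suc r))
        ≈⟨ +-cong (×-comm-* (e C suc r) ζ _) (reflexive (≡.cong (λ n → (e C r) × (ζ ^ n)) e∸r≡1+e∸1+r)) ⟨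
      ζ * ((e C suc r) × ζ ^ (e ℕ.∸ suc r)) + (e C r) × (ζ ^ (e ℕ.∸ r))
        ≈⟨ +-cong (*-congˡ (reflexive (powerTaylor-≤ e ζ (suc r) r<e)))
                  (reflexive (powerTaylor-≤ e ζ r (ℕₚ.<⇒≤ r<e))) ⟨
      ζ * powerTaylor e ζ (suc r) + powerTaylor e ζ r
        ∎
      where
      e∸r≡1+e∸1+r : e ℕ.∸ r ≡ suc (e ℕ.∸ suc r)
      e∸r≡1+e∸1+r = ℕₚ.+-∸-assoc 1 r<e
    by-cases e (no r≮e) (yes r≤e) with ℕₚ.≤-antisym r≤e (ℕₚ.≤-pred (ℕₚ.≰⇒> r≮e))
    ... | ≡.refl = begin
      powerTaylor (suc r) ζ (suc r)
        ≈⟨ reflexive (powerTaylor-≤ (suc r) ζ (suc r) ℕₚ.≤-refl) ⟩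
      (suc r C suc r) × (ζ ^ (r ℕ.∸ r))
        ≈⟨ reflexive (≡.cong₂ _×_ (≡.trans (nCn≡1 (suc r)) (≡.sym (nCn≡1 r))) ≡.refl) ⟩
      (r C r) × (ζ ^ (r ℕ.∸ r))
        ≈⟨ +-identityˡ _ ⟨
      0# + (r C r) × (ζ ^ (r ℕ.∸ r))
        ≈⟨ +-cong (zeroʳ ζ) (reflexive (powerTaylor-≤ r ζ r r≤e)) ⟨
      ζ * 0# + powerTaylor r ζ r
        ≈⟨ +-congʳ (*-congˡ (reflexive (powerTaylor-> r ζ (suc r) r≮e))) ⟨
      ζ * powerTaylor r ζ (suc r) + powerTaylor r ζ r
        ∎
    by-cases e (no r≮e) (no r≰e) = begin
      powerTaylor (suc e) ζ (suc r)
        ≈⟨ reflexive (powerTaylor-> (suc e) ζ (suc r) (r≰e ∘ ℕₚ.≤-pred)) ⟩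
      0#
        ≈⟨ trans (+-identityʳ (ζ * 0#)) (zeroʳ ζ) ⟨
      ζ * 0# + 0#
        ≈⟨ +-cong (*-congˡ (reflexive (powerTaylor-> e ζ (suc r) r≮e))) (reflexive (powerTaylor-> e ζ r r≰e)) ⟨
      ζ * powerTaylor e ζ (suc r) + powerTaylor e ζ r
        ∎

module CompleteHomogeneous {c ℓ} (R : CommutativeRing c ℓ) where
  open CommutativeRing R hiding (zero)
  open RangeSum R
  open import Algebra.Definitions.RawSemiring (Algebra.Bundles.Semiring.rawSemiring semiring) using (_^_)
  open import Algebra.Solver.Ring.NaturalCoefficients.Default commutativeSemiring
  import Data.List as List
  open import Data.List using ([]; _∷_)
  open import Data.Vec using ([]; _∷_; _∷ʳ_)
  open import Relation.Binary.Reasoning.Setoid setoid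

  monomial : ∀ {n} → Vec Carrier n → Vec ℕ n → Carrier
  monomial x k = prodVec R (Vec.zipWith _^_ x k)

  sumList-map-++ : ∀ {a} {A : Set a} (f : A → Carrier) (xs ys : List A) →
    sumList R (List.map f (xs List.++ ys)) ≈ sumList R (List.map f xs) + sumList R (List.map f ys)
  sumList-map-++ f []       ys = sym (+-identityˡ _)
  sumList-map-++ f (x ∷ xs) ys = trans (+-congˡ (sumList-map-++ f xs ys)) (sym (+-assoc _ _ _))

  sumList-map-concatMap : ∀ {a} {A : Set a} (f : A → Carrier) (g : ℕ → List A) (ns : List ℕ) →
    sumList R (List.map f (List.concatMap g ns)) ≈ sumList R (List.map (λ n → sumList R (List.map f (g n))) ns)
  sumList-map-concatMap f g []       = refl
  sumList-map-concatMap f g (n ∷ ns) =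
    trans (sumList-map-++ f (g n) (List.concatMap g ns)) (+-congˡ (sumList-map-concatMap f g ns))

  sumList-map-applyUpTo : ∀ (f : ℕ → Carrier) (g : ℕ → ℕ) n →
    sumList R (List.map f (List.applyUpTo g n)) ≈ sumUpTo n (f ∘ g)
  sumList-map-applyUpTo f g zero    = refl
  sumList-map-applyUpTo f g (suc n) = +-congˡ (sumList-map-applyUpTo f (g ∘ suc) n)

  compositions-suc : ∀ m n → compositions m (suc n) ≡
    List.concatMap (λ k → List.map (k ∷_) (compositions (m ℕ.∸ k) n)) (List.upTo (suc m))
  compositions-suc zero    n = ≡.refl
  compositions-suc (suc m) n = ≡.refl

  sumList-monomial-∷ : ∀ {n} x (xs : Vec Carrier n) k (ks : List (Vec ℕ n)) →
    sumList R (List.map (monomial (x ∷ xs)) (List.map (k ∷_) ks)) ≈ x ^ k * sumList R (List.map (monomial xs) ks)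
  sumList-monomial-∷ x xs k []       = sym (zeroʳ _)
  sumList-monomial-∷ x xs k (_ ∷ ks) = trans (+-congˡ (sumList-monomial-∷ x xs k ks)) (sym (distribˡ _ _ _))

  hcomplete-∷ : ∀ {n} m x (xs : Vec Carrier n) →
    hcomplete R m (x ∷ xs) ≈ sumUpTo (suc m) (λ k → x ^ k * hcomplete R (m ℕ.∸ k) xs)
  hcomplete-∷ {n} m x xs = begin
    hcomplete R m (x ∷ xs)
      ≈⟨ reflexive (≡.cong (sumList R ∘ List.map (monomial (x ∷ xs))) (compositions-suc m n)) ⟩
    sumList R (List.map (monomial (x ∷ xs)) (List.concatMap block (List.upTo (suc m))))
      ≈⟨ sumList-map-concatMap (monomial (x ∷ xs)) block (List.upTo (suc m)) ⟩
    sumList R (List.map (λ k → sumList R (List.map (monomial (x ∷ xs)) (block k))) (List.upTo (suc m)))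
      ≈⟨ sumList-map-applyUpTo (λ k → sumList R (List.map (monomial (x ∷ xs)) (block k))) id (suc m) ⟩
    sumUpTo (suc m) (λ k → sumList R (List.map (monomial (x ∷ xs)) (block k)))
      ≈⟨ sumUpTo-cong (suc m) (λ k _ → sumList-monomial-∷ x xs k (compositions (m ℕ.∸ k) n)) ⟩
    sumUpTo (suc m) (λ k → x ^ k * hcomplete R (m ℕ.∸ k) xs)
      ∎
    where
    block : ℕ → List (Vec ℕ (suc n))
    block k = List.map (k ∷_) (compositions (m ℕ.∸ k) n)

  hcomplete-zero : ∀ {n} (xs : Vec Carrier n) → hcomplete R 0 xs ≈ 1#
  hcomplete-zero []       = +-identityʳ 1#
  hcomplete-zero (x ∷ xs) =
    trans (hcomplete-∷ 0 x xs) (trans (+-identityʳ _) (trans (*-identityˡ _) (hcomplete-zero xs)))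

  hcomplete-suc-∷ : ∀ {n} m x (xs : Vec Carrier n) →
    hcomplete R (suc m) (x ∷ xs) ≈ hcomplete R (suc m) xs + x * hcomplete R m (x ∷ xs)
  hcomplete-suc-∷ m x xs = begin
    hcomplete R (suc m) (x ∷ xs)
      ≈⟨ hcomplete-∷ (suc m) x xs ⟩
    1# * hcomplete R (suc m) xs + sumUpTo (suc m) (λ k → (x * x ^ k) * hcomplete R (m ℕ.∸ k) xs)
      ≈⟨ +-cong (*-identityˡ _) (trans (sumUpTo-cong (suc m) (λ k _ → *-assoc x (x ^ k) (hcomplete R (m ℕ.∸ k) xs)))
                                       (sym (*-distribˡ-sumUpTo (suc m) x (λ k → x ^ k * hcomplete R (m ℕ.∸ k) xs)))) ⟩
    hcomplete R (suc m) xs + x * sumUpTo (suc m) (λ k → x ^ k * hcomplete R (m ℕ.∸ k) xs)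
      ≈⟨ +-congˡ (*-congˡ (hcomplete-∷ m x xs)) ⟨
    hcomplete R (suc m) xs + x * hcomplete R m (x ∷ xs)
      ∎

  hcomplete-suc-∷ʳ : ∀ {n} (xs : Vec Carrier n) x m →
    hcomplete R (suc m) (xs ∷ʳ x) ≈ hcomplete R (suc m) xs + x * hcomplete R m (xs ∷ʳ x)
  hcomplete-suc-∷ʳ []       x m       = hcomplete-suc-∷ m x []
  hcomplete-suc-∷ʳ (y ∷ xs) x zero    = begin
    hcomplete R 1 (y ∷ (xs ∷ʳ x))
      ≈⟨ hcomplete-suc-∷ 0 y (xs ∷ʳ x) ⟩
    hcomplete R 1 (xs ∷ʳ x) + y * hcomplete R 0 (y ∷ (xs ∷ʳ x))
      ≈⟨ +-cong (hcomplete-suc-∷ʳ xs x 0) (*-congˡ (hcomplete-zero (y ∷ (xs ∷ʳ x)))) ⟩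
    (hcomplete R 1 xs + x * hcomplete R 0 (xs ∷ʳ x)) + y * 1#
      ≈⟨ +-congʳ (+-congˡ (*-congˡ (hcomplete-zero (xs ∷ʳ x)))) ⟩
    (hcomplete R 1 xs + x * 1#) + y * 1#
      ≈⟨ solve 3 (λ h x y → (h :+ x :* con 1) :+ y :* con 1 := (h :+ y :* con 1) :+ x :* con 1) refl _ x y ⟩
    (hcomplete R 1 xs + y * 1#) + x * 1#
      ≈⟨ +-cong (trans (hcomplete-suc-∷ 0 y xs) (+-congˡ (*-congˡ (hcomplete-zero (y ∷ xs)))))
                (*-congˡ (hcomplete-zero (y ∷ (xs ∷ʳ x)))) ⟨
    hcomplete R 1 (y ∷ xs) + x * hcomplete R 0 (y ∷ (xs ∷ʳ x))
      ∎
  hcomplete-suc-∷ʳ (y ∷ xs) x (suc m) = begin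
    hcomplete R (suc (suc m)) (y ∷ (xs ∷ʳ x))
      ≈⟨ hcomplete-suc-∷ (suc m) y (xs ∷ʳ x) ⟩
    hcomplete R (suc (suc m)) (xs ∷ʳ x) + y * hcomplete R (suc m) (y ∷ (xs ∷ʳ x))
      ≈⟨ +-cong (hcomplete-suc-∷ʳ xs x (suc m)) (*-congˡ (hcomplete-suc-∷ʳ (y ∷ xs) x m)) ⟩
    (hcomplete R (suc (suc m)) xs + x * hcomplete R (suc m) (xs ∷ʳ x)) +
      y * (hcomplete R (suc m) (y ∷ xs) + x * hcomplete R m (y ∷ (xs ∷ʳ x)))
      ≈⟨ solve 6 (λ a x y b c d → (a :+ x :* b) :+ y :* (c :+ x :* d) := (a :+ y :* c) :+ x :* (b :+ y :* d))
               refl _ x y _ _ _ ⟩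
    (hcomplete R (suc (suc m)) xs + y * hcomplete R (suc m) (y ∷ xs)) +
      x * (hcomplete R (suc m) (xs ∷ʳ x) + y * hcomplete R m (y ∷ (xs ∷ʳ x)))
      ≈⟨ +-cong (hcomplete-suc-∷ (suc m) y xs) (*-congˡ (hcomplete-suc-∷ m y (xs ∷ʳ x))) ⟨
    hcomplete R (suc (suc m)) (y ∷ xs) + x * hcomplete R (suc m) (y ∷ (xs ∷ʳ x))
      ∎

open import Data.Product using (_×_)

module Determinant {c ℓ} (R : CommutativeRing c ℓ) where
  open CommutativeRing R hiding (zero)
  open import Algebra.Properties.Ring ring
    using (-‿distribˡ-*; -‿distribʳ-*; -‿involutive; -0#≈0#; +-inverseˡ-unique)
  open import Algebra.Properties.Semiring.Sum semiring
    using (sum-syntax; sum-cong-≋; sum-replicate-zero; ∑-distrib-+; ∑-comm; *-distribˡ-sum; *-distribʳ-sum)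
  open import Algebra.Solver.Ring.NaturalCoefficients.Default commutativeSemiring
  open import Data.Vec.Functional using (_∷_; removeAt; tail)
  open import Relation.Binary.Reasoning.Setoid setoid

  Row : ℕ → Set c
  Row n = Fin n → Carrier

  Matrix : ℕ → Set c
  Matrix k = Fin k → Row k

  sign : ℕ → Carrier
  sign i = signed R i 1#

  minor : ∀ {k} → Matrix (suc k) → Fin (suc k) → Matrix k
  minor M p i = removeAt (M (suc i)) p

  -- the length is explicit because Agda cannot infer the summands from a sum that unfolds by length
  ∑-cong : ∀ k {f g : Fin k → Carrier} → (∀ i → f i ≈ g i) → ∑[ i < k ] f i ≈ ∑[ i < k ] g i
  ∑-cong k = sum-cong-≋

  ∑-zero : ∀ k {f : Fin k → Carrier} → (∀ i → f i ≈ 0#) → ∑[ i < k ] f i ≈ 0#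
  ∑-zero k f≈0 = trans (∑-cong k f≈0) (sum-replicate-zero k)

  sumFin≡∑ : ∀ k (f : Fin k → Carrier) → sumFin R k f ≡ ∑[ i < k ] f i
  sumFin≡∑ zero    f = ≡.refl
  sumFin≡∑ (suc k) f = ≡.cong (f zero +_) (sumFin≡∑ k (tail f))

  signed≈sign* : ∀ i x → signed R i x ≈ sign i * x
  signed≈sign* zero    x = sym (*-identityˡ x)
  signed≈sign* (suc i) x = trans (-‿cong (signed≈sign* i x)) (-‿distribˡ-* (sign i) x)

  det-laplace : ∀ k (M : Matrix (suc k)) →
    det R (suc k) M ≈ ∑[ p < suc k ] (sign (toℕ p) * (M zero p * det R k (minor M p)))
  det-laplace k M = trans (reflexive (sumFin≡∑ (suc k) (λ p → signed R (toℕ p) (entry p))))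
                          (∑-cong (suc k) (λ p → signed≈sign* (toℕ p) (entry p)))
    where
    entry : Fin (suc k) → Carrier
    entry p = M zero p * det R k (minor M p)

  det-cong : ∀ k {A B : Matrix k} → (∀ i j → A i j ≈ B i j) → det R k A ≈ det R k B
  det-cong zero    A≈B = refl
  det-cong (suc k) {A} {B} A≈B = begin
    det R (suc k) A
      ≈⟨ det-laplace k A ⟩
    ∑[ p < suc k ] (sign (toℕ p) * (A zero p * det R k (minor A p)))
      ≈⟨ ∑-cong (suc k) (λ p → *-congˡ {sign (toℕ p)}
           (*-cong (A≈B zero p) (det-cong k (λ i l → A≈B (suc i) (punchIn p l))))) ⟩
    ∑[ p < suc k ] (sign (toℕ p) * (B zero p * det R k (minor B p)))
      ≈⟨ det-laplace k B ⟨
    det R (suc k) B ∎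

  det-linear : ∀ k (i : Fin k) {K} (a : Fin K → Carrier) (A : Matrix k) (B : Fin K → Matrix k) →
    (∀ q j → j ≢ i → ∀ l → B q j l ≈ A j l) →
    (∀ l → A i l ≈ ∑[ q < K ] (a q * B q i l)) →
    det R k A ≈ ∑[ q < K ] (a q * det R k (B q))
  det-linear (suc k) i {K} a A B agree row-i = begin
    det R (suc k) A
      ≈⟨ det-laplace k A ⟩
    ∑[ p < suc k ] (sign (toℕ p) * (A zero p * det R k (minor A p)))
      ≈⟨ ∑-cong (suc k) (expandTerm i agree row-i) ⟩
    ∑[ p < suc k ] ∑[ q < K ] (a q * term q p)
      ≈⟨ ∑-comm (λ p q → a q * term q p) ⟩
    ∑[ q < K ] ∑[ p < suc k ] (a q * term q p)
      ≈⟨ ∑-cong K (λ q → trans (*-congˡ (det-laplace k (B q))) (*-distribˡ-sum (a q) (term q))) ⟨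
    ∑[ q < K ] (a q * det R (suc k) (B q))
      ∎
    where
    term : Fin K → Fin (suc k) → Carrier
    term q p = sign (toℕ p) * (B q zero p * det R k (minor (B q) p))

    rearrange₀ : ∀ s a b d → s * ((a * b) * d) ≈ a * (s * (b * d))
    rearrange₀ = solve 4 (λ s a b d → s :* ((a :* b) :* d) := a :* (s :* (b :* d))) refl

    rearrange₁ : ∀ s x a d → s * (x * (a * d)) ≈ a * (s * (x * d))
    rearrange₁ = solve 4 (λ s x a d → s :* (x :* (a :* d)) := a :* (s :* (x :* d))) refl

    expandTerm : ∀ i → (∀ q j → j ≢ i → ∀ l → B q j l ≈ A j l) →
      (∀ l → A i l ≈ ∑[ q < K ] (a q * B q i l)) → ∀ p →
      sign (toℕ p) * (A zero p * det R k (minor A p)) ≈ ∑[ q < K ] (a q * term q p)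
    expandTerm zero agree row-0 p = begin
      s * (A zero p * d)
        ≈⟨ *-congˡ (*-congʳ (row-0 p)) ⟩
      s * (∑[ q < K ] (a q * B q zero p) * d)
        ≈⟨ *-congˡ (*-distribʳ-sum d (λ q → a q * B q zero p)) ⟩
      s * ∑[ q < K ] ((a q * B q zero p) * d)
        ≈⟨ *-distribˡ-sum s (λ q → (a q * B q zero p) * d) ⟩
      ∑[ q < K ] (s * ((a q * B q zero p) * d))
        ≈⟨ ∑-cong K (λ q → trans (rearrange₀ s (a q) (B q zero p) d)
             (*-congˡ (*-congˡ (*-congˡ (det-cong k (λ i l → sym (agree q (suc i) (λ ()) (punchIn p l)))))))) ⟩
      ∑[ q < K ] (a q * term q p)
        ∎
      where
      s d : Carrier
      s = sign (toℕ p)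
      d = det R k (minor A p)
    expandTerm (suc i) agree row-i p = begin
      s * (A zero p * det R k (minor A p))
        ≈⟨ *-congˡ (*-congˡ (det-linear k i a (minor A p) (λ q → minor (B q) p)
             (λ q j j≢i l → agree q (suc j) (λ e → j≢i (Finₚ.suc-injective e)) (punchIn p l))
             (λ l → row-i (punchIn p l)))) ⟩
      s * (A zero p * ∑[ q < K ] (a q * det R k (minor (B q) p)))
        ≈⟨ *-congˡ (*-distribˡ-sum (A zero p) (λ q → a q * det R k (minor (B q) p))) ⟩
      s * ∑[ q < K ] (A zero p * (a q * det R k (minor (B q) p)))
        ≈⟨ *-distribˡ-sum s (λ q → A zero p * (a q * det R k (minor (B q) p))) ⟩
      ∑[ q < K ] (s * (A zero p * (a q * det R k (minor (B q) p))))
        ≈⟨ ∑-cong K (λ q → trans (rearrange₁ s (A zero p) (a q) _)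
             (*-congˡ (*-congˡ (*-congʳ (sym (agree q zero (λ ()) p)))))) ⟩
      ∑[ q < K ] (a q * term q p)
        ∎
      where
      s : Carrier
      s = sign (toℕ p)

  restrict : ∀ {m n k} → (Fin m → Row n) → (Fin k → Fin n) → Fin m → Row k
  restrict T σ i = T i ∘ σ

  det-restrict-cong : ∀ k {n} (T : Fin k → Row n) {σ τ : Fin k → Fin n} →
    (∀ m → σ m ≡ τ m) → det R k (restrict T σ) ≈ det R k (restrict T τ)
  det-restrict-cong k T σ≗τ = det-cong k (λ i m → reflexive (≡.cong (T i) (σ≗τ m)))

  det-minor-∷ : ∀ k (u v : Row (suc (suc k))) (T : Fin k → Row (suc (suc k))) p →
    det R (suc k) (minor (u ∷ v ∷ T) p) ≈ det R (suc k) (removeAt v p ∷ λ i → removeAt (T i) p)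
  det-minor-∷ k u v T p = det-cong (suc k) {minor (u ∷ v ∷ T) p} {removeAt v p ∷ λ i → removeAt (T i) p}
    λ { zero l → refl ; (suc i) l → refl }

  det-two-rows : ∀ k (u v : Row (suc (suc k))) (T : Fin k → Row (suc (suc k))) →
    det R (suc (suc k)) (u ∷ v ∷ T) ≈
      ∑[ p < suc (suc k) ] ∑[ l < suc k ] ((sign (toℕ p) * sign (toℕ l)) *
        ((u p * v (punchIn p l)) * det R k (restrict T (punchIn p ∘ punchIn l))))
  det-two-rows k u v T = begin
    det R (suc (suc k)) (u ∷ v ∷ T)
      ≈⟨ det-laplace (suc k) (u ∷ v ∷ T) ⟩
    ∑[ p < suc (suc k) ] (sign (toℕ p) * (u p * det R (suc k) (minor (u ∷ v ∷ T) p)))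
      ≈⟨ ∑-cong (suc (suc k)) (λ p → *-congˡ {sign (toℕ p)} (*-congˡ {u p}
           (trans (det-minor-∷ k u v T p) (det-laplace k (removeAt v p ∷ λ i → removeAt (T i) p))))) ⟩
    ∑[ p < suc (suc k) ] (sign (toℕ p) * (u p * ∑[ l < suc k ] inner p l))
      ≈⟨ ∑-cong (suc (suc k)) distribute ⟩
    ∑[ p < suc (suc k) ] ∑[ l < suc k ] ((sign (toℕ p) * sign (toℕ l)) *
        ((u p * v (punchIn p l)) * det R k (restrict T (punchIn p ∘ punchIn l))))
      ∎
    where
    inner : Fin (suc (suc k)) → Fin (suc k) → Carrier
    inner p l = sign (toℕ l) * (v (punchIn p l) * det R k (restrict T (punchIn p ∘ punchIn l)))

    rearrange : ∀ s x t y d → s * (x * (t * (y * d))) ≈ (s * t) * ((x * y) * d)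
    rearrange = solve 5 (λ s x t y d → s :* (x :* (t :* (y :* d))) := (s :* t) :* ((x :* y) :* d)) refl

    distribute : ∀ p → sign (toℕ p) * (u p * ∑[ l < suc k ] inner p l) ≈
      ∑[ l < suc k ] ((sign (toℕ p) * sign (toℕ l)) *
        ((u p * v (punchIn p l)) * det R k (restrict T (punchIn p ∘ punchIn l))))
    distribute p = begin
      sign (toℕ p) * (u p * ∑[ l < suc k ] inner p l)
        ≈⟨ *-congˡ (*-distribˡ-sum (u p) (inner p)) ⟩
      sign (toℕ p) * ∑[ l < suc k ] (u p * inner p l)
        ≈⟨ *-distribˡ-sum (sign (toℕ p)) (λ l → u p * inner p l) ⟩
      ∑[ l < suc k ] (sign (toℕ p) * (u p * inner p l))
        ≈⟨ ∑-cong (suc k) (λ l → rearrange (sign (toℕ p)) (u p) (sign (toℕ l)) (v (punchIn p l))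
             (det R k (restrict T (punchIn p ∘ punchIn l)))) ⟩
      ∑[ l < suc k ] ((sign (toℕ p) * sign (toℕ l)) *
        ((u p * v (punchIn p l)) * det R k (restrict T (punchIn p ∘ punchIn l))))
        ∎

  -[x]*-[y]≈x*y : ∀ x y → (- x) * (- y) ≈ x * y
  -[x]*-[y]≈x*y x y = begin
    (- x) * (- y)  ≈⟨ -‿distribˡ-* x (- y) ⟨
    - (x * - y)    ≈⟨ -‿cong (-‿distribʳ-* x y) ⟨
    - - (x * y)    ≈⟨ -‿involutive (x * y) ⟩
    x * y          ∎

  -- The terms with p = 0 or l = 0 cancel in pairs; the others form the same sum one size smaller.
  ∑-pairs-cancel : ∀ k (β : Fin (suc (suc k)) → Fin (suc (suc k)) → Carrier) → (∀ p q → β p q ≈ β q p) →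
    (f : (Fin k → Fin (suc (suc k))) → Carrier) → (∀ {σ τ} → (∀ m → σ m ≡ τ m) → f σ ≈ f τ) →
    ∑[ p < suc (suc k) ] ∑[ l < suc k ]
      ((sign (toℕ p) * sign (toℕ l)) * (β p (punchIn p l) * f (punchIn p ∘ punchIn l))) ≈ 0#
  ∑-pairs-cancel k β β-sym f f-resp = begin
    X₀ + ∑[ p < suc k ] (Y p + Z p)
      ≈⟨ +-congˡ (∑-distrib-+ Y Z) ⟩
    X₀ + (∑[ p < suc k ] Y p + ∑[ p < suc k ] Z p)
      ≈⟨ +-assoc X₀ _ _ ⟨
    (X₀ + ∑[ p < suc k ] Y p) + ∑[ p < suc k ] Z p
      ≈⟨ +-congʳ (∑-distrib-+ (term zero) Y) ⟨
    ∑[ l < suc k ] (term zero l + Y l) + ∑[ p < suc k ] Z p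
      ≈⟨ +-cong (∑-zero (suc k) edge-cancels) (interior-cancels k β β-sym f f-resp) ⟩
    0# + 0#
      ≈⟨ +-identityˡ 0# ⟩
    0# ∎
    where
    term : Fin (suc (suc k)) → Fin (suc k) → Carrier
    term p l = (sign (toℕ p) * sign (toℕ l)) * (β p (punchIn p l) * f (punchIn p ∘ punchIn l))
    X₀ : Carrier
    X₀ = ∑[ l < suc k ] term zero l
    Y Z : Fin (suc k) → Carrier
    Y p = term (suc p) zero
    Z p = ∑[ l < k ] term (suc p) (suc l)

    edge-cancels : ∀ l → term zero l + Y l ≈ 0#
    edge-cancels l = begin
      (1# * s) * (β zero (suc l) * F) + (- s * 1#) * (β (suc l) zero * F)
        ≈⟨ +-cong (trans (*-congʳ (*-identityˡ s)) (*-congˡ (*-congʳ (β-sym zero (suc l)))))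
                  (trans (*-congʳ (*-identityʳ (- s))) (sym (-‿distribˡ-* s _))) ⟩
      s * (β (suc l) zero * F) + - (s * (β (suc l) zero * F))
        ≈⟨ -‿inverseʳ _ ⟩
      0# ∎
      where
      s F : Carrier
      s = sign (toℕ l)
      F = f (λ m → suc (punchIn l m))

    interior-cancels : ∀ k (β : Fin (suc (suc k)) → Fin (suc (suc k)) → Carrier) → (∀ p q → β p q ≈ β q p) →
      (f : (Fin k → Fin (suc (suc k))) → Carrier) → (∀ {σ τ} → (∀ m → σ m ≡ τ m) → f σ ≈ f τ) →
      ∑[ p < suc k ] ∑[ l < k ] ((sign (toℕ (suc p)) * sign (toℕ (suc l))) *
        (β (suc p) (punchIn (suc p) (suc l)) * f (punchIn (suc p) ∘ punchIn (suc l)))) ≈ 0#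
    interior-cancels zero    β β-sym f f-resp = ∑-zero 1 (λ p → refl)
    interior-cancels (suc k) β β-sym f f-resp = begin
      ∑[ p < suc (suc k) ] ∑[ l < suc k ] ((- sign (toℕ p) * - sign (toℕ l)) *
        (β (suc p) (suc (punchIn p l)) * f (punchIn (suc p) ∘ punchIn (suc l))))
        ≈⟨ ∑-cong (suc (suc k)) (λ p → ∑-cong (suc k) (λ l →
             *-cong (-[x]*-[y]≈x*y (sign (toℕ p)) (sign (toℕ l)))
                    (*-congˡ {β (suc p) (suc (punchIn p l))} (f-resp (lift-punchIn p l))))) ⟩
      ∑[ p < suc (suc k) ] ∑[ l < suc k ] ((sign (toℕ p) * sign (toℕ l)) *
        (β (suc p) (suc (punchIn p l)) * f (Fin.lift 1 (punchIn p ∘ punchIn l))))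
        ≈⟨ ∑-pairs-cancel k (λ p q → β (suc p) (suc q)) (λ p q → β-sym (suc p) (suc q))
             (f ∘ Fin.lift 1) f-resp′ ⟩
      0# ∎
      where
      lift-punchIn : ∀ p l m → (punchIn (suc p) ∘ punchIn (suc l)) m ≡ Fin.lift 1 (punchIn p ∘ punchIn l) m
      lift-punchIn p l zero    = ≡.refl
      lift-punchIn p l (suc m) = ≡.refl

      f-resp′ : ∀ {σ τ} → (∀ m → σ m ≡ τ m) → f (Fin.lift 1 σ) ≈ f (Fin.lift 1 τ)
      f-resp′ σ≗τ = f-resp λ { zero → ≡.refl ; (suc m) → ≡.cong suc (σ≗τ m) }

  det-equal-rows₀₁ : ∀ k (u : Row (suc (suc k))) (T : Fin k → Row (suc (suc k))) →
    det R (suc (suc k)) (u ∷ u ∷ T) ≈ 0#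
  det-equal-rows₀₁ k u T = trans (det-two-rows k u u T)
    (∑-pairs-cancel k (λ p q → u p * u q) (λ p q → *-comm (u p) (u q))
      (det R k ∘ restrict T) (det-restrict-cong k T))

  det-swap-rows₀₁ : ∀ k (u v : Row (suc (suc k))) (T : Fin k → Row (suc (suc k))) →
    det R (suc (suc k)) (u ∷ v ∷ T) + det R (suc (suc k)) (v ∷ u ∷ T) ≈ 0#
  det-swap-rows₀₁ k u v T = begin
    det R (suc (suc k)) (u ∷ v ∷ T) + det R (suc (suc k)) (v ∷ u ∷ T)
      ≈⟨ +-cong (det-two-rows k u v T) (det-two-rows k v u T) ⟩
    ∑[ p < suc (suc k) ] ∑[ l < suc k ] term u v p l + ∑[ p < suc (suc k) ] ∑[ l < suc k ] term v u p l
      ≈⟨ ∑-distrib-+ (λ p → ∑[ l < suc k ] term u v p l) (λ p → ∑[ l < suc k ] term v u p l) ⟨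
    ∑[ p < suc (suc k) ] (∑[ l < suc k ] term u v p l + ∑[ l < suc k ] term v u p l)
      ≈⟨ ∑-cong (suc (suc k)) (λ p → ∑-distrib-+ (term u v p) (term v u p)) ⟨
    ∑[ p < suc (suc k) ] ∑[ l < suc k ] (term u v p l + term v u p l)
      ≈⟨ ∑-cong (suc (suc k)) (λ p → ∑-cong (suc k) (λ l → factor (sign (toℕ p) * sign (toℕ l))
           (u p) (v (punchIn p l)) (v p) (u (punchIn p l)) (det R k (restrict T (punchIn p ∘ punchIn l)))))⟩
    ∑[ p < suc (suc k) ] ∑[ l < suc k ] ((sign (toℕ p) * sign (toℕ l)) *
      (β p (punchIn p l) * det R k (restrict T (punchIn p ∘ punchIn l))))
      ≈⟨ ∑-pairs-cancel k β β-sym (det R k ∘ restrict T) (det-restrict-cong k T) ⟩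
    0# ∎
    where
    term : Row (suc (suc k)) → Row (suc (suc k)) → Fin (suc (suc k)) → Fin (suc k) → Carrier
    term u v p l = (sign (toℕ p) * sign (toℕ l)) *
      ((u p * v (punchIn p l)) * det R k (restrict T (punchIn p ∘ punchIn l)))

    β : Fin (suc (suc k)) → Fin (suc (suc k)) → Carrier
    β p q = u p * v q + v p * u q

    β-sym : ∀ p q → β p q ≈ β q p
    β-sym p q = solve 4 (λ a b c d → a :* b :+ c :* d := d :* c :+ b :* a) refl (u p) (v q) (v p) (u q)

    factor : ∀ s a b c e d → s * ((a * b) * d) + s * ((c * e) * d) ≈ s * ((a * b + c * e) * d)
    factor = solve 6 (λ s a b c e d → s :* ((a :* b) :* d) :+ s :* ((c :* e) :* d)
                                      := s :* ((a :* b :+ c :* e) :* d)) refl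

  det-repeated-row : ∀ k (v : Row (suc k)) (T : Fin k → Row (suc k)) (t : Fin k) →
    (∀ l → v l ≈ T t l) → det R (suc k) (v ∷ T) ≈ 0#
  det-repeated-row (suc k) v T zero v≈T₀ = begin
    det R (suc (suc k)) (v ∷ T)
      ≈⟨ det-cong (suc (suc k)) {v ∷ T} {v ∷ v ∷ tail T}
           (λ { zero l → refl ; (suc zero) l → sym (v≈T₀ l) ; (suc (suc i)) l → refl }) ⟩
    det R (suc (suc k)) (v ∷ v ∷ tail T)
      ≈⟨ det-equal-rows₀₁ k v (tail T) ⟩
    0# ∎
  det-repeated-row (suc k) v T (suc t) v≈Tₜ = begin
    det R (suc (suc k)) (v ∷ T)
      ≈⟨ det-cong (suc (suc k)) {v ∷ T} {v ∷ T zero ∷ tail T}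
           (λ { zero l → refl ; (suc zero) l → refl ; (suc (suc i)) l → refl }) ⟩
    det R (suc (suc k)) (v ∷ T zero ∷ tail T)
      ≈⟨ +-inverseˡ-unique _ _ (det-swap-rows₀₁ k v (T zero) (tail T)) ⟩
    - det R (suc (suc k)) (T zero ∷ v ∷ tail T)
      ≈⟨ -‿cong (trans (det-laplace (suc k) (T zero ∷ v ∷ tail T)) (∑-zero (suc (suc k)) minor-vanishes)) ⟩
    - 0#
      ≈⟨ -0#≈0# ⟩
    0# ∎
    where
    minor-vanishes : ∀ p → sign (toℕ p) * (T zero p * det R (suc k) (minor (T zero ∷ v ∷ tail T) p)) ≈ 0#
    minor-vanishes p = begin
      sign (toℕ p) * (T zero p * det R (suc k) (minor (T zero ∷ v ∷ tail T) p))
        ≈⟨ *-congˡ {sign (toℕ p)} (*-congˡ {T zero p} (trans (det-minor-∷ k (T zero) v (tail T) p)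
             (det-repeated-row k (removeAt v p) (λ i → removeAt (tail T i) p) t (λ l → v≈Tₜ (punchIn p l))))) ⟩
      sign (toℕ p) * (T zero p * 0#)
        ≈⟨ trans (*-congˡ {sign (toℕ p)} (zeroʳ (T zero p))) (zeroʳ (sign (toℕ p))) ⟩
      0# ∎

  det-row₀-combination : ∀ k h (b : Row (suc k)) (d : Fin k → Carrier) (A : Matrix (suc k)) →
    (∀ p → A zero p ≈ h * b p + ∑[ j < k ] (d j * A (suc j) p)) →
    det R (suc k) A ≈ h * det R (suc k) (b ∷ tail A)
  det-row₀-combination k h b d A row₀ = begin
    det R (suc k) A
      ≈⟨ det-linear (suc k) zero (h ∷ d) A (λ q → (b ∷ tail A) q ∷ tail A) agree row₀ ⟩
    h * det R (suc k) (b ∷ tail A) + ∑[ j < k ] (d j * det R (suc k) (A (suc j) ∷ tail A))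
      ≈⟨ +-congˡ (∑-zero k (λ j → trans (*-congˡ {d j} (det-repeated-row k (A (suc j)) (tail A) j (λ l → refl)))
                                         (zeroʳ (d j)))) ⟩
    h * det R (suc k) (b ∷ tail A) + 0#
      ≈⟨ +-identityʳ _ ⟩
    h * det R (suc k) (b ∷ tail A) ∎
    where
    agree : ∀ q j → j ≢ zero → ∀ l → ((b ∷ tail A) q ∷ tail A) j l ≈ A j l
    agree q zero    0≢0 l = ⊥-elim (0≢0 ≡.refl)
    agree q (suc j) _   l = refl

  AddLaterRows : ∀ m {n} → (Fin m → Row n) → (Fin m → Row n) → Set (c ⊔ˡ ℓ)
  AddLaterRows zero    A B = Lift _ ⊤
  AddLaterRows (suc m) A B =
    Σ (Fin m → Carrier) (λ d → ∀ p → A zero p ≈ B zero p + ∑[ j < m ] (d j * B (suc j) p))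
    × AddLaterRows m (tail A) (tail B)

  AddLaterRows-columns : ∀ m {n n′} (σ : Fin n′ → Fin n) {A B : Fin m → Row n} →
    AddLaterRows m A B → AddLaterRows m (restrict A σ) (restrict B σ)
  AddLaterRows-columns zero    σ rel              = rel
  AddLaterRows-columns (suc m) σ ((d , row₀) , rel) = (d , row₀ ∘ σ) , AddLaterRows-columns m σ rel

  det-AddLaterRows : ∀ k {A B : Matrix k} → AddLaterRows k A B → det R k A ≈ det R k B
  det-AddLaterRows zero    _ = refl
  det-AddLaterRows (suc k) {A} {B} ((d , row₀) , rel) = begin
    det R (suc k) A
      ≈⟨ det-laplace k A ⟩
    ∑[ p < suc k ] (sign (toℕ p) * (A zero p * det R k (minor A p)))
      ≈⟨ ∑-cong (suc k) (λ p → *-congˡ {sign (toℕ p)} (*-congˡ {A zero p}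
           (det-AddLaterRows k (AddLaterRows-columns k (punchIn p) rel)))) ⟩
    ∑[ p < suc k ] (sign (toℕ p) * (A zero p * det R k (minor B p)))
      ≈⟨ det-laplace k (A zero ∷ tail B) ⟨
    det R (suc k) (A zero ∷ tail B)
      ≈⟨ det-row₀-combination k 1# (B zero) d (A zero ∷ tail B)
           (λ p → trans (row₀ p) (+-congʳ (sym (*-identityˡ (B zero p))))) ⟩
    1# * det R (suc k) (B zero ∷ tail B)
      ≈⟨ *-identityˡ _ ⟩
    det R (suc k) (B zero ∷ tail B)
      ≈⟨ det-cong (suc k) {B zero ∷ tail B} {B} (λ { zero l → refl ; (suc i) l → refl }) ⟩
    det R (suc k) B ∎

toℕ-punchIn-fromℕ : ∀ k (l : Fin k) → toℕ (punchIn (fromℕ k) l) ≡ toℕ l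
toℕ-punchIn-fromℕ (suc k) zero    = ≡.refl
toℕ-punchIn-fromℕ (suc k) (suc l) = ≡.cong suc (toℕ-punchIn-fromℕ k l)

module FieldDeterminant {c ℓ} (F : Field c ℓ) where
  open Field F hiding (zero)
  open Determinant commutativeRing
  open import Algebra.Properties.Ring ring using (-‿distribˡ-*; -‿involutive; -0#≈0#)
  open import Algebra.Properties.Semiring.Sum semiring using (sum-syntax; sum-init-last)
  open import Algebra.Solver.Ring.NaturalCoefficients.Default commutativeSemiring
  open import Relation.Binary.Reasoning.Setoid setoid

  *-nonzero : ∀ {a b} → ¬ a ≈ 0# → ¬ b ≈ 0# → ¬ a * b ≈ 0#
  *-nonzero {a} {b} a≉0 b≉0 ab≈0 = b≉0 (begin
    b                           ≈⟨ *-identityˡ b ⟨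
    1# * b                      ≈⟨ *-congʳ (inverseʳ a a≉0) ⟨
    (a * inverse a a≉0) * b     ≈⟨ solve 3 (λ a a⁻¹ b → (a :* a⁻¹) :* b := (a :* b) :* a⁻¹)
                                          refl a (inverse a a≉0) b ⟩
    (a * b) * inverse a a≉0     ≈⟨ *-congʳ ab≈0 ⟩
    0# * inverse a a≉0          ≈⟨ zeroˡ _ ⟩
    0#                          ∎)

  x*d≈y⇒x≈y*d⁻¹ : ∀ {x y d} (d≉0 : ¬ d ≈ 0#) → x * d ≈ y → x ≈ y * inverse d d≉0
  x*d≈y⇒x≈y*d⁻¹ {x} {y} {d} d≉0 x*d≈y = begin
    x                              ≈⟨ *-identityʳ x ⟨
    x * 1#                         ≈⟨ *-congˡ (inverseʳ d d≉0) ⟨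
    x * (d * inverse d d≉0)        ≈⟨ *-assoc x d _ ⟨
    (x * d) * inverse d d≉0        ≈⟨ *-congʳ x*d≈y ⟩
    y * inverse d d≉0              ∎

  sign*≈0⇒≈0 : ∀ i {x} → sign i * x ≈ 0# → x ≈ 0#
  sign*≈0⇒≈0 zero    {x} 1x≈0 = trans (sym (*-identityˡ x)) 1x≈0
  sign*≈0⇒≈0 (suc i) {x} e = sign*≈0⇒≈0 i (begin
    sign i * x          ≈⟨ -‿involutive _ ⟨
    - - (sign i * x)    ≈⟨ -‿cong (trans (-‿distribˡ-* (sign i) x) e) ⟩
    - 0#                ≈⟨ -0#≈0# ⟩
    0#                  ∎)

  det-antitriangular-nonzero : ∀ k (A : Matrix k) →
    (∀ j p → suc (toℕ p ℕ.+ toℕ j) ℕ.< k → A j p ≈ 0#) →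
    (∀ j p → suc (toℕ p ℕ.+ toℕ j) ≡ k → ¬ A j p ≈ 0#) →
    ¬ det commutativeRing k A ≈ 0#
  det-antitriangular-nonzero zero    A _ _ 1≈0 = 0≉1 (sym 1≈0)
  det-antitriangular-nonzero (suc k) A below anti det≈0 =
    *-nonzero corner≉0 minor≉0 (sign*≈0⇒≈0 (toℕ (fromℕ k)) (trans (sym det≈last) det≈0))
    where
    term : Fin (suc k) → Carrier
    term p = sign (toℕ p) * (A zero p * det commutativeRing k (minor A p))

    p+0≡p : ∀ p → toℕ p ℕ.+ 0 ≡ toℕ p
    p+0≡p p = ℕₚ.+-identityʳ (toℕ p)

    det≈last : det commutativeRing (suc k) A ≈ term (fromℕ k)
    det≈last = begin
      det commutativeRing (suc k) A            ≈⟨ det-laplace k A ⟩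
      ∑[ p < suc k ] term p                    ≈⟨ sum-init-last term ⟩
      ∑[ i < k ] term (inject₁ i) + term (fromℕ k)
        ≈⟨ +-congʳ (∑-zero k (λ i → trans (*-congˡ (*-congʳ (below zero (inject₁ i) (ℕ.s≤s
             (≡.subst (ℕ._< k) (≡.sym (≡.trans (p+0≡p (inject₁ i)) (Finₚ.toℕ-inject₁ i))) (Finₚ.toℕ<n i))))))
             (trans (*-congˡ (zeroˡ _)) (zeroʳ _)))) ⟩
      0# + term (fromℕ k)                      ≈⟨ +-identityˡ _ ⟩
      term (fromℕ k)                           ∎

    corner≉0 : ¬ A zero (fromℕ k) ≈ 0#
    corner≉0 = anti zero (fromℕ k) (≡.cong suc (≡.trans (p+0≡p (fromℕ k)) (Finₚ.toℕ-fromℕ k)))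

    shift : ∀ (i : Fin k) l → toℕ (punchIn (fromℕ k) l) ℕ.+ toℕ (suc i) ≡ suc (toℕ l ℕ.+ toℕ i)
    shift i l = ≡.trans (≡.cong (ℕ._+ suc (toℕ i)) (toℕ-punchIn-fromℕ k l)) (ℕₚ.+-suc (toℕ l) (toℕ i))

    minor≉0 : ¬ det commutativeRing k (minor A (fromℕ k)) ≈ 0#
    minor≉0 = det-antitriangular-nonzero k (minor A (fromℕ k))
      (λ i l lt → below (suc i) (punchIn (fromℕ k) l) (ℕ.s≤s (≡.subst (ℕ._< k) (≡.sym (shift i l)) lt)))
      (λ i l eq → anti (suc i) (punchIn (fromℕ k) l) (≡.cong suc (≡.trans (shift i l) eq)))

module _ {a} {A : Set a} where
  open import Data.Vec using ([]; _∷_; _++_; _∷ʳ_; tabulate; replicate)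

  at : ∀ {n} → Vec A n → ℕ → A → A
  at []       t       d = d
  at (x ∷ xs) zero    d = x
  at (x ∷ xs) (suc t) d = at xs t d

  lookup≡at : ∀ {n} (xs : Vec A n) (p : Fin n) d → lookup xs p ≡ at xs (toℕ p) d
  lookup≡at (x ∷ xs) zero    d = ≡.refl
  lookup≡at (x ∷ xs) (suc p) d = lookup≡at xs p d

  at-++ˡ : ∀ {k n} (xs : Vec A k) (ys : Vec A n) t d → t ℕ.< k → at (xs ++ ys) t d ≡ at xs t d
  at-++ˡ (x ∷ xs) ys zero    d _           = ≡.refl
  at-++ˡ (x ∷ xs) ys (suc t) d (ℕ.s≤s t<k) = at-++ˡ xs ys t d t<k

  at-++ʳ : ∀ {k n} (xs : Vec A k) (ys : Vec A n) t d → at (xs ++ ys) (k ℕ.+ t) d ≡ at ys t d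
  at-++ʳ []       ys t d = ≡.refl
  at-++ʳ (x ∷ xs) ys t d = at-++ʳ xs ys t d

  at-tabulate : ∀ k (f : Fin k → A) t d (t<k : t ℕ.< k) → at (tabulate f) t d ≡ f (fromℕ< t<k)
  at-tabulate (suc k) f zero    d _           = ≡.refl
  at-tabulate (suc k) f (suc t) d (ℕ.s≤s t<k) = at-tabulate k (f ∘ suc) t d t<k

  at-replicate : ∀ k (x : A) t d → t ℕ.< k → at (replicate k x) t d ≡ x
  at-replicate (suc k) x zero    d _           = ≡.refl
  at-replicate (suc k) x (suc t) d (ℕ.s≤s t<k) = at-replicate k x t d t<k

  at-∷ʳ-< : ∀ {n} (xs : Vec A n) x t d → t ℕ.< n → at (xs ∷ʳ x) t d ≡ at xs t d
  at-∷ʳ-< (y ∷ xs) x zero    d _           = ≡.refl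
  at-∷ʳ-< (y ∷ xs) x (suc t) d (ℕ.s≤s t<n) = at-∷ʳ-< xs x t d t<n

  at-∷ʳ-≡ : ∀ {n} (xs : Vec A n) x d → at (xs ∷ʳ x) n d ≡ x
  at-∷ʳ-≡ []       x d = ≡.refl
  at-∷ʳ-≡ (y ∷ xs) x d = at-∷ʳ-≡ xs x d

m<n∸o⇒o+m<n : ∀ m n o → m ℕ.< n ℕ.∸ o → o ℕ.+ m ℕ.< n
m<n∸o⇒o+m<n m n       zero    m<n   = m<n
m<n∸o⇒o+m<n m (suc n) (suc o) m<n∸o = ℕ.s≤s (m<n∸o⇒o+m<n m n o m<n∸o)

-- Column t applies f ↦ f⁽ᵒʳᵈᵉʳ ᵗ⁾(node t)/(order t)!; the columns of one node are consecutive with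
-- orders 0, 1, 2, …, and nodes of earlier blocks differ from the node of t.
record ConfluentColumns {c ℓ} (R : CommutativeRing c ℓ) (N : ℕ) : Set (c ⊔ˡ ℓ) where
  open CommutativeRing R using (Carrier; _≈_)
  field
    node  : ℕ → Carrier
    order : ℕ → ℕ
    order≤index   : ∀ t → t ℕ.< N → order t ℕ.≤ t
    order-suc     : ∀ t r → suc t ℕ.< N → order (suc t) ≡ suc r → node t ≡ node (suc t) × order t ≡ r
    node-distinct : ∀ p t → p ℕ.< N → t ℕ.< p ℕ.∸ order p → ¬ node t ≈ node p

confluentMatrix : ∀ {c ℓ} {R : CommutativeRing c ℓ} {N} → ConfluentColumns R N → List ℕ →
  Fin N → Fin N → CommutativeRing.Carrier R
confluentMatrix {R = R} {N} cols lam j p = Gentry R N lam (node (toℕ p)) (order (toℕ p)) (toℕ j)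
  where open ConfluentColumns cols

partPart-onePart-1 : ∀ m → partPart (onePart m) 1 ≡ m
partPart-onePart-1 zero    = ≡.refl
partPart-onePart-1 (suc m) = ≡.refl

partPart-onePart-2+ : ∀ m j → partPart (onePart m) (suc (suc j)) ≡ 0
partPart-onePart-2+ zero    j = ≡.refl
partPart-onePart-2+ (suc m) j = ≡.refl

module NewtonBasis {c ℓ} {R : CommutativeRing c ℓ} {N′ : ℕ} (cols : ConfluentColumns R (suc N′)) where
  open CommutativeRing R hiding (zero)
  open ConfluentColumns cols
  open RangeSum R
  open PowerTaylor R
  open CompleteHomogeneous R
  open Determinant R
  open import Algebra.Properties.Semiring.Sum semiring using (sum-syntax)
  open import Data.Vec.Functional using (_∷_; tail)
  open import Algebra.Solver.Ring.NaturalCoefficients.Default commutativeSemiring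
  open import Algebra.Properties.Semiring.Mult semiring using (×-homo-1)
  open import Relation.Binary.Reasoning.Setoid setoid

  N : ℕ
  N = suc N′

  -- the coefficient of (x − ζ)^r in (x − node 0)⋯(x − node (i − 1))
  newtonTaylor : ℕ → Carrier → ℕ → Carrier
  newtonTaylor zero    ζ zero    = 1#
  newtonTaylor zero    ζ (suc r) = 0#
  newtonTaylor (suc i) ζ r       = (ζ - node i) * newtonTaylor i ζ r + previous (newtonTaylor i ζ) r

  newtonAt : ℕ → ℕ → Carrier
  newtonAt i t = newtonTaylor i (node t) (order t)

  -- x^M = Σ_i newtonCoeff M i · (x − node 0)⋯(x − node (i − 1))
  newtonCoeff : ℕ → ℕ → Carrier
  newtonCoeff zero    zero    = 1#
  newtonCoeff zero    (suc i) = 0#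
  newtonCoeff (suc M) zero    = node 0 * newtonCoeff M zero
  newtonCoeff (suc M) (suc i) = newtonCoeff M i + node (suc i) * newtonCoeff M (suc i)

  BlockPosition : ℕ → Set c
  BlockPosition t =
    order t ≡ 0 ⊎ Σ ℕ (λ t′ → t ≡ suc t′ × node t′ ≡ node t × order t ≡ suc (order t′))

  blockPosition : ∀ t → t ℕ.< N → BlockPosition t
  blockPosition zero    0<N = inj₁ (ℕₚ.n≤0⇒n≡0 (order≤index 0 0<N))
  blockPosition (suc t) t<N with order (suc t) in eq
  ... | zero   = inj₁ ≡.refl
  ... | suc r with order-suc t r t<N eq
  ...   | same-node , order≡r = inj₂ (t , ≡.refl , same-node , ≡.cong suc (≡.sym order≡r))

  newtonAt-vanishes : ∀ i t → t ℕ.< N → t ℕ.< i → newtonAt i t ≈ 0#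
  newtonAt-vanishes (suc i) t t<N t<1+i =
    trans (+-cong (factor-vanishes (ℕₚ.m<1+n⇒m<n∨m≡n t<1+i)) (previous-vanishes (blockPosition t t<N)))
          (+-identityˡ 0#)
    where
    factor-vanishes : t ℕ.< i ⊎ t ≡ i → (node t - node i) * newtonAt i t ≈ 0#
    factor-vanishes (inj₁ t<i) = trans (*-congˡ (newtonAt-vanishes i t t<N t<i)) (zeroʳ _)
    factor-vanishes (inj₂ ≡.refl) = trans (*-congʳ (-‿inverseʳ (node t))) (zeroˡ _)

    previous-vanishes : BlockPosition t → previous (newtonTaylor i (node t)) (order t) ≈ 0#
    previous-vanishes (inj₁ order≡0) = reflexive (≡.cong (previous (newtonTaylor i (node t))) order≡0)
    previous-vanishes (inj₂ (t′ , ≡.refl , same-node , order≡1+)) = begin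
      previous (newtonTaylor i (node t)) (order t)
        ≈⟨ reflexive (≡.cong (previous (newtonTaylor i (node t))) order≡1+) ⟩
      newtonTaylor i (node t) (order t′)
        ≈⟨ reflexive (≡.cong (λ ζ → newtonTaylor i ζ (order t′)) (≡.sym same-node)) ⟩
      newtonAt i t′
        ≈⟨ newtonAt-vanishes i t′ (ℕₚ.<-trans (ℕₚ.n<1+n t′) t<N) (ℕₚ.≤-pred t<1+i) ⟩
      0# ∎

  newtonCoeff-vanishes : ∀ M i → M ℕ.< i → newtonCoeff M i ≈ 0#
  newtonCoeff-vanishes zero    (suc i) _            = refl
  newtonCoeff-vanishes (suc M) (suc i) (ℕ.s≤s M<i) = trans
    (+-cong (newtonCoeff-vanishes M i M<i)
            (trans (*-congˡ (newtonCoeff-vanishes M (suc i) (ℕₚ.m≤n⇒m≤1+n M<i))) (zeroʳ _)))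
    (+-identityˡ 0#)

  newtonCoeff-diagonal : ∀ M → newtonCoeff M M ≈ 1#
  newtonCoeff-diagonal zero    = refl
  newtonCoeff-diagonal (suc M) = trans
    (+-cong (newtonCoeff-diagonal M)
            (trans (*-congˡ (newtonCoeff-vanishes M (suc M) (ℕₚ.n<1+n M))) (zeroʳ _)))
    (+-identityʳ 1#)

  newtonExpansion : ℕ → ℕ → Carrier
  newtonExpansion M t = sumUpTo N (λ i → newtonCoeff M i * newtonAt i t)

  -- x · P_i = P_(i+1) + node i · P_i, and P_N vanishes on every column.
  newtonExpansion-suc : ∀ M t → t ℕ.< N →
    node t * newtonExpansion M t + sumUpTo N (λ i → newtonCoeff M i * previous (newtonTaylor i (node t)) (order t))
      ≈ newtonExpansion (suc M) t
  newtonExpansion-suc M t t<N = begin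
    ζ * sumUpTo N (λ i → K i * W i) + sumUpTo N (λ i → K i * P i)
      ≈⟨ +-congʳ (*-distribˡ-sumUpTo N ζ (λ i → K i * W i)) ⟩
    sumUpTo N (λ i → ζ * (K i * W i)) + sumUpTo N (λ i → K i * P i)
      ≈⟨ sumUpTo-distrib-+ N (λ i → ζ * (K i * W i)) (λ i → K i * P i) ⟨
    sumUpTo N (λ i → ζ * (K i * W i) + K i * P i)
      ≈⟨ sumUpTo-cong N (λ i _ → multiply-by-node i) ⟩
    sumUpTo N (λ i → K i * W (suc i) + node i * (K i * W i))
      ≈⟨ sumUpTo-distrib-+ N (λ i → K i * W (suc i)) (λ i → node i * (K i * W i)) ⟩
    sumUpTo N (λ i → K i * W (suc i)) + (node 0 * (K 0 * W 0) + S₂)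
      ≈⟨ +-congʳ (trans (sumUpTo-suc N′ (λ i → K i * W (suc i)))
           (trans (+-congˡ (trans (*-congˡ (newtonAt-vanishes N t t<N t<N)) (zeroʳ _))) (+-identityʳ _))) ⟩
    S₁ + (node 0 * (K 0 * W 0) + S₂)
      ≈⟨ solve 5 (λ a z k w b → a :+ (z :* (k :* w) :+ b) := (z :* k) :* w :+ (a :+ b))
               refl S₁ (node 0) (K 0) (W 0) S₂ ⟩
    (node 0 * K 0) * W 0 + (S₁ + S₂)
      ≈⟨ +-congˡ (sumUpTo-distrib-+ N′ (λ i → K i * W (suc i)) (λ i → node (suc i) * (K (suc i) * W (suc i)))) ⟨
    (node 0 * K 0) * W 0 + sumUpTo N′ (λ i → K i * W (suc i) + node (suc i) * (K (suc i) * W (suc i)))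
      ≈⟨ +-congˡ (sumUpTo-cong N′ (λ i _ → solve 4 (λ a z b w → a :* w :+ z :* (b :* w) := (a :+ z :* b) :* w)
                                              refl (K i) (node (suc i)) (K (suc i)) (W (suc i)))) ⟩
    newtonExpansion (suc M) t ∎
    where
    ζ : Carrier
    ζ = node t
    K : ℕ → Carrier
    K = newtonCoeff M
    W P : ℕ → Carrier
    W i = newtonAt i t
    P i = previous (newtonTaylor i ζ) (order t)
    S₁ S₂ : Carrier
    S₁ = sumUpTo N′ (λ i → K i * W (suc i))
    S₂ = sumUpTo N′ (λ i → node (suc i) * (K (suc i) * W (suc i)))

    multiply-by-node : ∀ i → ζ * (K i * W i) + K i * P i ≈ K i * W (suc i) + node i * (K i * W i)
    multiply-by-node i = begin
      ζ * (K i * W i) + K i * P i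
        ≈⟨ +-identityʳ _ ⟨
      (ζ * (K i * W i) + K i * P i) + 0#
        ≈⟨ +-congˡ (trans (*-congʳ (-‿inverseˡ (node i))) (zeroˡ _)) ⟨
      (ζ * (K i * W i) + K i * P i) + (- node i + node i) * (K i * W i)
        ≈⟨ solve 6 (λ ζ a b k w p → (ζ :* (k :* w) :+ k :* p) :+ (a :+ b) :* (k :* w)
                                   := k :* ((ζ :+ a) :* w :+ p) :+ b :* (k :* w))
                   refl ζ (- node i) (node i) (K i) (W i) (P i) ⟩
      K i * W (suc i) + node i * (K i * W i) ∎

  powerTaylor-newton : ∀ M t → t ℕ.< N → powerTaylor M (node t) (order t) ≈ newtonExpansion M t
  powerTaylor-newton zero t t<N = begin
    powerTaylor 0 (node t) (order t)                     ≈⟨ power0≈newton0 (order t) ⟩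
    newtonAt 0 t                                          ≈⟨ *-identityˡ _ ⟨
    1# * newtonAt 0 t                                     ≈⟨ +-identityʳ _ ⟨
    1# * newtonAt 0 t + 0#                                ≈⟨ +-congˡ (sumUpTo-zero N′ (λ i _ → zeroˡ _)) ⟨
    1# * newtonAt 0 t + sumUpTo N′ (λ i → 0# * newtonAt (suc i) t) ∎
    where
    power0≈newton0 : ∀ r → powerTaylor 0 (node t) r ≈ newtonTaylor 0 (node t) r
    power0≈newton0 zero    = trans (reflexive (powerTaylor-≤ 0 (node t) 0 ℕ.z≤n)) (×-homo-1 1#)
    power0≈newton0 (suc r) = reflexive (powerTaylor-> 0 (node t) (suc r) λ ())
  powerTaylor-newton (suc M) t t<N = begin
    powerTaylor (suc M) ζ (order t)
      ≈⟨ powerTaylor-suc M ζ (order t) ⟩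
    ζ * powerTaylor M ζ (order t) + previous (powerTaylor M ζ) (order t)
      ≈⟨ +-cong (*-congˡ (powerTaylor-newton M t t<N)) (previous-expansion (blockPosition t t<N)) ⟩
    ζ * newtonExpansion M t + sumUpTo N (λ i → newtonCoeff M i * previous (newtonTaylor i ζ) (order t))
      ≈⟨ newtonExpansion-suc M t t<N ⟩
    newtonExpansion (suc M) t ∎
    where
    ζ : Carrier
    ζ = node t

    previous-expansion : BlockPosition t → previous (powerTaylor M ζ) (order t) ≈
      sumUpTo N (λ i → newtonCoeff M i * previous (newtonTaylor i ζ) (order t))
    previous-expansion (inj₁ order≡0) rewrite order≡0 = sym (sumUpTo-zero N (λ i _ → zeroʳ (newtonCoeff M i)))
    previous-expansion (inj₂ (t′ , ≡.refl , same-node , order≡1+)) rewrite order≡1+ | ≡.sym same-node =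
      powerTaylor-newton M t′ (ℕₚ.<-trans (ℕₚ.n<1+n t′) t<N)

  powerRow newtonRow : ℕ → Row N
  powerRow  e p = powerTaylor e (node (toℕ p)) (order (toℕ p))
  newtonRow e p = newtonAt e (toℕ p)

  descending : ∀ {m} → (ℕ → Row N) → Fin m → Row N
  descending {m} row j = row (m ℕ.∸ suc (toℕ j))

  powerRow-newton-truncated : ∀ M e → suc e ℕ.≤ N → (∀ i → e ℕ.< i → i ℕ.< N → newtonCoeff M i ≈ 0#) → ∀ p →
    powerRow M p ≈
      newtonCoeff M e * newtonRow e p + ∑[ j < e ] (newtonCoeff M (e ℕ.∸ suc (toℕ j)) * descending newtonRow j p)
  powerRow-newton-truncated M e e<N above-e p = begin
    powerRow M p
      ≈⟨ powerTaylor-newton M (toℕ p) (Finₚ.toℕ<n p) ⟩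
    sumUpTo N term
      ≈⟨ reflexive (≡.cong (λ n → sumUpTo n term) (≡.sym (ℕₚ.m+[n∸m]≡n e<N))) ⟩
    sumUpTo (suc e ℕ.+ (N ℕ.∸ suc e)) term
      ≈⟨ sumUpTo-split (suc e) (N ℕ.∸ suc e) term ⟩
    sumUpTo (suc e) term + sumUpTo (N ℕ.∸ suc e) (λ i → term (suc e ℕ.+ i))
      ≈⟨ +-congˡ (sumUpTo-zero (N ℕ.∸ suc e) (λ i i<N∸1+e → trans
           (*-congʳ (above-e (suc e ℕ.+ i) (ℕ.s≤s (ℕₚ.m≤m+n e i)) (m<n∸o⇒o+m<n i N (suc e) i<N∸1+e)))
           (zeroˡ _))) ⟩
    sumUpTo (suc e) term + 0#
      ≈⟨ +-identityʳ _ ⟩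
    sumUpTo (suc e) term
      ≈⟨ sumUpTo-suc e term ⟩
    sumUpTo e term + term e
      ≈⟨ +-comm _ _ ⟩
    term e + sumUpTo e term
      ≈⟨ +-congˡ (sumUpTo-reverse e term) ⟩
    term e + ∑[ j < e ] term (e ℕ.∸ suc (toℕ j)) ∎
    where
    term : ℕ → Carrier
    term i = newtonCoeff M i * newtonAt i (toℕ p)

  powerRows-AddLaterRows : ∀ m → m ℕ.≤ N → AddLaterRows m (descending {m} powerRow) (descending {m} newtonRow)
  powerRows-AddLaterRows zero    _   = lift _
  powerRows-AddLaterRows (suc e) e<N =
    ((λ j → newtonCoeff e (e ℕ.∸ suc (toℕ j))) , top-row) , powerRows-AddLaterRows e (ℕₚ.<⇒≤ e<N)
    where
    top-row : ∀ p → powerRow e p ≈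
      newtonRow e p + ∑[ j < e ] (newtonCoeff e (e ℕ.∸ suc (toℕ j)) * descending newtonRow j p)
    top-row p = trans (powerRow-newton-truncated e e e<N (λ i e<i _ → newtonCoeff-vanishes e i e<i) p)
                      (+-congʳ (trans (*-congʳ (newtonCoeff-diagonal e)) (*-identityˡ _)))

  powerMatrix newtonMatrix : Matrix N
  powerMatrix  = descending powerRow
  newtonMatrix = descending newtonRow

  shiftedPowerMatrix : ℕ → Matrix N
  shiftedPowerMatrix m = powerRow (N′ ℕ.+ m) ∷ tail powerMatrix

  det-powerMatrix : det R N powerMatrix ≈ det R N newtonMatrix
  det-powerMatrix = det-AddLaterRows N {powerMatrix} {newtonMatrix} (powerRows-AddLaterRows N ℕₚ.≤-refl)

  det-shiftedPowerMatrix : ∀ m → det R N (shiftedPowerMatrix m) ≈ newtonCoeff (N′ ℕ.+ m) N′ * det R N newtonMatrix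
  det-shiftedPowerMatrix m = begin
    det R N (shiftedPowerMatrix m)
      ≈⟨ det-AddLaterRows N {shiftedPowerMatrix m} {powerRow (N′ ℕ.+ m) ∷ tail newtonMatrix}
           (((λ _ → 0#) , unchanged) , powerRows-AddLaterRows N′ (ℕₚ.n≤1+n N′)) ⟩
    det R N (powerRow (N′ ℕ.+ m) ∷ tail newtonMatrix)
      ≈⟨ det-row₀-combination N′ (newtonCoeff (N′ ℕ.+ m) N′) (newtonRow N′)
           (λ j → newtonCoeff (N′ ℕ.+ m) (N′ ℕ.∸ suc (toℕ j))) (powerRow (N′ ℕ.+ m) ∷ tail newtonMatrix)
           (powerRow-newton-truncated (N′ ℕ.+ m) N′ ℕₚ.≤-refl nothing-above) ⟩
    newtonCoeff (N′ ℕ.+ m) N′ * det R N (newtonRow N′ ∷ tail newtonMatrix)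
      ≈⟨ *-congˡ (det-cong N {newtonRow N′ ∷ tail newtonMatrix} {newtonMatrix}
           (λ { zero p → refl ; (suc j) p → refl })) ⟩
    newtonCoeff (N′ ℕ.+ m) N′ * det R N newtonMatrix ∎
    where
    unchanged : ∀ p → powerRow (N′ ℕ.+ m) p ≈ powerRow (N′ ℕ.+ m) p + ∑[ j < N′ ] (0# * tail newtonMatrix j p)
    unchanged p = sym (trans (+-congˡ (∑-zero N′ (λ j → zeroˡ _))) (+-identityʳ _))

    nothing-above : ∀ i → N′ ℕ.< i → i ℕ.< N → newtonCoeff (N′ ℕ.+ m) i ≈ 0#
    nothing-above i N′<i i<N = ⊥-elim (ℕₚ.<-irrefl ≡.refl (ℕₚ.<-≤-trans N′<i (ℕₚ.≤-pred i<N)))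

  confluentMatrix-emptyPart : ∀ j p → confluentMatrix cols emptyPart j p ≡ powerMatrix j p
  confluentMatrix-emptyPart j p = ≡.trans (Gentry≡powerTaylor N emptyPart (node (toℕ p)) (order (toℕ p)) (toℕ j))
    (≡.cong (λ e → powerTaylor (e ℕ.∸ suc (toℕ j)) (node (toℕ p)) (order (toℕ p))) (ℕₚ.+-identityʳ N))

  confluentMatrix-onePart : ∀ m j p → confluentMatrix cols (onePart m) j p ≡ shiftedPowerMatrix m j p
  confluentMatrix-onePart m zero p = ≡.trans (Gentry≡powerTaylor N (onePart m) (node (toℕ p)) (order (toℕ p)) 0)
    (≡.cong (λ λ₁ → powerTaylor (N′ ℕ.+ λ₁) (node (toℕ p)) (order (toℕ p))) (partPart-onePart-1 m))
  confluentMatrix-onePart m (suc j) p = ≡.trans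
    (Gentry≡powerTaylor N (onePart m) (node (toℕ p)) (order (toℕ p)) (suc (toℕ j)))
    (≡.trans (≡.cong (λ λ₂ → powerTaylor (N ℕ.+ λ₂ ℕ.∸ suc (suc (toℕ j))) (node (toℕ p)) (order (toℕ p)))
                     (partPart-onePart-2+ m (toℕ j)))
             (≡.cong (λ e → powerTaylor (e ℕ.∸ suc (suc (toℕ j))) (node (toℕ p)) (order (toℕ p))) (ℕₚ.+-identityʳ N)))

  det-confluentMatrix-emptyPart : det R N (confluentMatrix cols emptyPart) ≈ det R N powerMatrix
  det-confluentMatrix-emptyPart = det-cong N (λ j p → reflexive (confluentMatrix-emptyPart j p))

  det-confluentMatrix-onePart : ∀ m → det R N (confluentMatrix cols (onePart m)) ≈ det R N (shiftedPowerMatrix m)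
  det-confluentMatrix-onePart m = det-cong N (λ j p → reflexive (confluentMatrix-onePart m j p))

  nodes : (i : ℕ) → Vec Carrier i
  nodes zero    = Vec.[]
  nodes (suc i) = nodes i Vec.∷ʳ node i

  nodes-at : ∀ i (v : Vec Carrier i) → (∀ t → t ℕ.< i → node t ≡ at v t 0#) → nodes i ≡ v
  nodes-at zero    Vec.[] _ = ≡.refl
  nodes-at (suc i) v node≡ with Vec.initLast v
  ... | u , x , ≡.refl = ≡.cong₂ Vec._∷ʳ_
    (nodes-at i u (λ t t<i → ≡.trans (node≡ t (ℕₚ.m<n⇒m<1+n t<i)) (at-∷ʳ-< u x t 0# t<i)))
    (≡.trans (node≡ i (ℕₚ.n<1+n i)) (at-∷ʳ-≡ u x 0#))

  newtonCoeff≈hcomplete : ∀ i m → newtonCoeff (i ℕ.+ m) i ≈ hcomplete R m (nodes (suc i))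
  newtonCoeff≈hcomplete zero m = first-column m
    where
    first-column : ∀ m → newtonCoeff m 0 ≈ hcomplete R m (nodes 1)
    first-column zero    = sym (hcomplete-zero (nodes 1))
    first-column (suc m) = sym (trans (hcomplete-suc-∷ m (node 0) Vec.[])
                                      (trans (+-identityˡ _) (*-congˡ (sym (first-column m)))))
  newtonCoeff≈hcomplete (suc i) zero = begin
    newtonCoeff (suc i ℕ.+ 0) (suc i)
      ≈⟨ reflexive (≡.cong (λ M → newtonCoeff M (suc i)) (ℕₚ.+-identityʳ (suc i))) ⟩
    newtonCoeff (suc i) (suc i)           ≈⟨ newtonCoeff-diagonal (suc i) ⟩
    1#                                    ≈⟨ hcomplete-zero (nodes (suc (suc i))) ⟨
    hcomplete R 0 (nodes (suc (suc i)))   ∎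
  newtonCoeff≈hcomplete (suc i) (suc m) = begin
    newtonCoeff (i ℕ.+ suc m) i + node (suc i) * newtonCoeff (i ℕ.+ suc m) (suc i)
      ≈⟨ +-congˡ (*-congˡ (reflexive (≡.cong (λ M → newtonCoeff M (suc i)) (ℕₚ.+-suc i m)))) ⟩
    newtonCoeff (i ℕ.+ suc m) i + node (suc i) * newtonCoeff (suc i ℕ.+ m) (suc i)
      ≈⟨ +-cong (newtonCoeff≈hcomplete i (suc m)) (*-congˡ (newtonCoeff≈hcomplete (suc i) m)) ⟩
    hcomplete R (suc m) (nodes (suc i)) + node (suc i) * hcomplete R m (nodes (suc (suc i)))
      ≈⟨ hcomplete-suc-∷ʳ (nodes (suc i)) (node (suc i)) m ⟨
    hcomplete R (suc m) (nodes (suc (suc i))) ∎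

  det-shiftedPowerMatrix≈hcomplete* : ∀ m →
    det R N (shiftedPowerMatrix m) ≈ hcomplete R m (nodes N) * det R N powerMatrix
  det-shiftedPowerMatrix≈hcomplete* m =
    trans (det-shiftedPowerMatrix m) (*-cong (newtonCoeff≈hcomplete N′ m) (sym det-powerMatrix))

  node-block : ∀ t → t ℕ.< N → ∀ j → j ℕ.< order t → node (t ℕ.∸ order t ℕ.+ j) ≡ node t
  node-block zero    0<N j j<order =
    ⊥-elim (ℕₚ.n≮0 (≡.subst (j ℕ.<_) (ℕₚ.n≤0⇒n≡0 (order≤index 0 0<N)) j<order))
  node-block (suc t) t<N j j<order with blockPosition (suc t) t<N
  ... | inj₁ order≡0 = ⊥-elim (ℕₚ.n≮0 (≡.subst (j ℕ.<_) order≡0 j<order))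
  ... | inj₂ (t , ≡.refl , same-node , order≡1+) rewrite order≡1+ =
    ≡.trans (within-block (ℕₚ.m<1+n⇒m<n∨m≡n j<order)) same-node
    where
    within-block : j ℕ.< order t ⊎ j ≡ order t → node (t ℕ.∸ order t ℕ.+ j) ≡ node t
    within-block (inj₁ j<order) = node-block t (ℕₚ.<-trans (ℕₚ.n<1+n t) t<N) j j<order
    within-block (inj₂ ≡.refl)  = ≡.cong node (ℕₚ.m∸n+n≡m (order≤index t (ℕₚ.<-trans (ℕₚ.n<1+n t) t<N)))

  newtonTaylor-through-block : ∀ j s ζ → (∀ j′ → j′ ℕ.< j → node (s ℕ.+ j′) ≡ ζ) →
    newtonTaylor (s ℕ.+ j) ζ j ≈ newtonTaylor s ζ 0
  newtonTaylor-through-block zero    s ζ _     = reflexive (≡.cong (λ i → newtonTaylor i ζ 0) (ℕₚ.+-identityʳ s))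
  newtonTaylor-through-block (suc j) s ζ block = begin
    newtonTaylor (s ℕ.+ suc j) ζ (suc j)
      ≈⟨ reflexive (≡.cong (λ i → newtonTaylor i ζ (suc j)) (ℕₚ.+-suc s j)) ⟩
    (ζ - node (s ℕ.+ j)) * newtonTaylor (s ℕ.+ j) ζ (suc j) + newtonTaylor (s ℕ.+ j) ζ j
      ≈⟨ +-cong (trans (*-congʳ (trans (-‿congʳ (block j (ℕₚ.n<1+n j))) (-‿inverseʳ ζ))) (zeroˡ _))
                (newtonTaylor-through-block j s ζ (λ j′ j′<j → block j′ (ℕₚ.m<n⇒m<1+n j′<j))) ⟩
    0# + newtonTaylor s ζ 0
      ≈⟨ +-identityˡ _ ⟩
    newtonTaylor s ζ 0 ∎
    where
    -‿congʳ : ∀ {x y} → x ≡ y → ζ - x ≈ ζ - y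
    -‿congʳ ≡.refl = refl

module NewtonBasisNonsingular {c ℓ} (F : Field c ℓ) {N′ : ℕ}
  (cols : ConfluentColumns (Field.commutativeRing F) (suc N′)) where
  open Field F hiding (zero)
  open ConfluentColumns cols
  open NewtonBasis cols
  open FieldDeterminant F
  open import Algebra.Properties.AbelianGroup +-abelianGroup using (x∙y⁻¹≈ε⇒x≈y)
  open import Relation.Binary.Reasoning.Setoid setoid

  newtonTaylor-nonzero : ∀ s ζ → (∀ t → t ℕ.< s → ¬ node t ≈ ζ) → ¬ newtonTaylor s ζ 0 ≈ 0#
  newtonTaylor-nonzero zero    ζ _        1≈0 = 0≉1 (sym 1≈0)
  newtonTaylor-nonzero (suc s) ζ distinct e =
    *-nonzero (λ ζ-zₛ≈0 → distinct s (ℕₚ.n<1+n s) (sym (x∙y⁻¹≈ε⇒x≈y ζ (node s) ζ-zₛ≈0)))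
              (newtonTaylor-nonzero s ζ (λ t t<s → distinct t (ℕₚ.m<n⇒m<1+n t<s)))
              (trans (sym (+-identityʳ _)) e)

  newtonAt-diagonal-nonzero : ∀ t → t ℕ.< N → ¬ newtonAt t t ≈ 0#
  newtonAt-diagonal-nonzero t t<N newtonAt≈0 =
    newtonTaylor-nonzero s (node t) (λ t′ t′<s → node-distinct t t′ t<N t′<s) (begin
      newtonTaylor s (node t) 0                       ≈⟨ newtonTaylor-through-block (order t) s (node t) (node-block t t<N) ⟨
      newtonTaylor (s ℕ.+ order t) (node t) (order t) ≡⟨ ≡.cong (λ i → newtonTaylor i (node t) (order t)) s+order≡t ⟩
      newtonAt t t                                    ≈⟨ newtonAt≈0 ⟩
      0#                                              ∎)
    where
    s : ℕ
    s = t ℕ.∸ order t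
    s+order≡t : s ℕ.+ order t ≡ t
    s+order≡t = ℕₚ.m∸n+n≡m (order≤index t t<N)

  det-newtonMatrix-nonzero : ¬ det commutativeRing N newtonMatrix ≈ 0#
  det-newtonMatrix-nonzero = det-antitriangular-nonzero N newtonMatrix
    (λ j p p+j<N → newtonAt-vanishes (N ℕ.∸ suc (toℕ j)) (toℕ p) (Finₚ.toℕ<n p)
       (ℕₚ.m+n≤o⇒m≤o∸n (suc (toℕ p)) (≡.subst (ℕ._≤ N) (≡.cong suc (≡.sym (ℕₚ.+-suc (toℕ p) (toℕ j)))) p+j<N)))
    (λ j p p+j≡N → ≡.subst (λ i → ¬ newtonAt i (toℕ p) ≈ 0#)
       (≡.sym (≡.trans (≡.cong (ℕ._∸ suc (toℕ j)) (≡.sym p+j≡N)) (ℕₚ.m+n∸n≡m (toℕ p) (toℕ j))))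
       (newtonAt-diagonal-nonzero (toℕ p) (Finₚ.toℕ<n p)))

  det-powerMatrix-nonzero : ¬ det commutativeRing N powerMatrix ≈ 0#
  det-powerMatrix-nonzero det≈0 = det-newtonMatrix-nonzero (trans (sym det-powerMatrix) det≈0)

module _ {c ℓ} (R : CommutativeRing c ℓ) where
  open CommutativeRing R hiding (zero)
  open Determinant R
  open import Relation.Binary.Reasoning.Setoid setoid

  hcomplete*det-confluentMatrix : ∀ N → 1 ℕ.≤ N → (cols : ConfluentColumns R N) → ∀ m (v : Vec Carrier N) →
    (∀ t → t ℕ.< N → ConfluentColumns.node cols t ≡ at v t 0#) →
    hcomplete R m v * det R N (confluentMatrix cols emptyPart) ≈ det R N (confluentMatrix cols (onePart m))
  hcomplete*det-confluentMatrix (suc N′) _ cols m v node≡ = begin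
    hcomplete R m v * det R N (confluentMatrix cols emptyPart)
      ≈⟨ *-cong (reflexive (≡.cong (hcomplete R m) (nodes-at N v node≡))) (sym det-confluentMatrix-emptyPart) ⟨
    hcomplete R m (nodes N) * det R N powerMatrix
      ≈⟨ det-shiftedPowerMatrix≈hcomplete* m ⟨
    det R N (shiftedPowerMatrix m)
      ≈⟨ det-confluentMatrix-onePart m ⟨
    det R N (confluentMatrix cols (onePart m)) ∎
    where open NewtonBasis cols

module _ {c ℓ} (F : Field c ℓ) where
  open Field F hiding (zero)

  det-confluentMatrix-emptyPart-nonzero : ∀ N → 1 ℕ.≤ N → (cols : ConfluentColumns commutativeRing N) →
    ¬ det commutativeRing N (confluentMatrix cols emptyPart) ≈ 0#
  det-confluentMatrix-emptyPart-nonzero (suc N′) _ cols det≈0 =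
    det-powerMatrix-nonzero (trans (sym det-confluentMatrix-emptyPart) det≈0)
    where
    open NewtonBasis cols
    open NewtonBasisNonsingular F cols

open import Data.Vec using ([]; _∷_; _++_; tabulate; replicate)

split< : ∀ k n t → t ℕ.< k ℕ.+ n → t ℕ.< k ⊎ Σ ℕ (λ t′ → t ≡ k ℕ.+ t′ × t′ ℕ.< n)
split< zero    n t       t<n   = inj₂ (t , ≡.refl , t<n)
split< (suc k) n zero    _     = inj₁ (ℕ.s≤s ℕ.z≤n)
split< (suc k) n (suc t) (ℕ.s≤s t<k+n) with split< k n t t<k+n
... | inj₁ t<k              = inj₁ (ℕ.s≤s t<k)
... | inj₂ (t′ , t≡ , t′<n) = inj₂ (t′ , ≡.cong suc t≡ , t′<n)

offsets : ∀ {n} → (κ : Vec ℕ n) → Vec ℕ (sum κ)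
offsets []      = []
offsets (k ∷ κ) = tabulate {n = k} toℕ ++ offsets κ

at-offsets-0 : ∀ {n} (κ : Vec ℕ n) → at (offsets κ) 0 0 ≡ 0
at-offsets-0 []          = ≡.refl
at-offsets-0 (zero ∷ κ)  = at-offsets-0 κ
at-offsets-0 (suc k ∷ κ) = ≡.refl

at-offsets-< : ∀ {n} k (κ : Vec ℕ n) t → t ℕ.< k → at (offsets (k ∷ κ)) t 0 ≡ t
at-offsets-< k κ t t<k = ≡.trans (at-++ˡ (tabulate {n = k} toℕ) (offsets κ) t 0 t<k)
                                 (≡.trans (at-tabulate k toℕ t 0 t<k) (Finₚ.toℕ-fromℕ< t<k))

at-offsets-+ : ∀ {n} k (κ : Vec ℕ n) t → at (offsets (k ∷ κ)) (k ℕ.+ t) 0 ≡ at (offsets κ) t 0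
at-offsets-+ k κ t = at-++ʳ (tabulate {n = k} toℕ) (offsets κ) t 0

at-offsets≤ : ∀ {n} (κ : Vec ℕ n) t → t ℕ.< sum κ → at (offsets κ) t 0 ℕ.≤ t
at-offsets≤ (k ∷ κ) t t<N with split< k (sum κ) t t<N
... | inj₁ t<k                   = ℕₚ.≤-reflexive (at-offsets-< k κ t t<k)
... | inj₂ (t′ , ≡.refl , t′<N) = ≡.subst (ℕ._≤ k ℕ.+ t′) (≡.sym (at-offsets-+ k κ t′))
                                          (ℕₚ.≤-trans (at-offsets≤ κ t′ t′<N) (ℕₚ.m≤n+m t′ k))

module ExpandedColumns {c ℓ} (R : CommutativeRing c ℓ) where
  open CommutativeRing R hiding (zero)
  open Determinant R using (det-cong)
  open import Relation.Binary.Reasoning.Setoid setoid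

  at-expand-< : ∀ {n} y (ys : Vec Carrier n) k κ t d → t ℕ.< k → at (expand R (y ∷ ys) (k ∷ κ)) t d ≡ y
  at-expand-< y ys k κ t d t<k = ≡.trans (at-++ˡ (replicate k y) (expand R ys κ) t d t<k) (at-replicate k y t d t<k)

  at-expand-+ : ∀ {n} y (ys : Vec Carrier n) k κ t d →
    at (expand R (y ∷ ys) (k ∷ κ)) (k ℕ.+ t) d ≡ at (expand R ys κ) t d
  at-expand-+ y ys k κ t d = at-++ʳ (replicate k y) (expand R ys κ) t d

  at-expand-lookup : ∀ {n} (ys : Vec Carrier n) κ t → t ℕ.< sum κ →
    Σ (Fin n) (λ q → at (expand R ys κ) t 0# ≡ lookup ys q)
  at-expand-lookup (y ∷ ys) (k ∷ κ) t t<N with split< k (sum κ) t t<N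
  ... | inj₁ t<k                   = zero , at-expand-< y ys k κ t 0# t<k
  ... | inj₂ (t′ , ≡.refl , t′<N) with at-expand-lookup ys κ t′ t′<N
  ...   | q , at≡ = suc q , ≡.trans (at-expand-+ y ys k κ t′ 0#) at≡

  expand-order-suc : ∀ {n} (ys : Vec Carrier n) κ t r → suc t ℕ.< sum κ → at (offsets κ) (suc t) 0 ≡ suc r →
    at (expand R ys κ) t 0# ≡ at (expand R ys κ) (suc t) 0# × at (offsets κ) t 0 ≡ r
  expand-order-suc (y ∷ ys) (k ∷ κ) t r 1+t<N offset≡ with split< k (sum κ) (suc t) 1+t<N
  ... | inj₁ 1+t<k =
    ≡.trans (at-expand-< y ys k κ t 0# t<k) (≡.sym (at-expand-< y ys k κ (suc t) 0# 1+t<k)) ,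
    ≡.trans (at-offsets-< k κ t t<k) (ℕₚ.suc-injective (≡.trans (≡.sym (at-offsets-< k κ (suc t) 1+t<k)) offset≡))
    where
    t<k : t ℕ.< k
    t<k = ℕₚ.<-trans (ℕₚ.n<1+n t) 1+t<k
  ... | inj₂ (zero , 1+t≡k+0 , _) = ⊥-elim (ℕₚ.0≢1+n (≡.trans (≡.sym block-start) offset≡))
    where
    block-start : at (offsets (k ∷ κ)) (suc t) 0 ≡ 0
    block-start = ≡.trans (≡.cong (λ i → at (offsets (k ∷ κ)) i 0) 1+t≡k+0)
                          (≡.trans (at-offsets-+ k κ 0) (at-offsets-0 κ))
  ... | inj₂ (suc t′ , 1+t≡k+1+t′ , 1+t′<N) with ℕₚ.suc-injective (≡.trans 1+t≡k+1+t′ (ℕₚ.+-suc k t′))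
  ...   | ≡.refl with expand-order-suc ys κ t′ r 1+t′<N
                        (≡.trans (≡.sym (at-offsets-+ k κ (suc t′)))
                                 (≡.trans (≡.cong (λ i → at (offsets (k ∷ κ)) i 0) (≡.sym 1+t≡k+1+t′)) offset≡))
  ...     | same-node , order≡ =
    ≡.trans (at-expand-+ y ys k κ t′ 0#)
      (≡.trans same-node (≡.sym (≡.trans (≡.cong (λ i → at (expand R (y ∷ ys) (k ∷ κ)) i 0#) 1+t≡k+1+t′)
                                          (at-expand-+ y ys k κ (suc t′) 0#)))) ,
    ≡.trans (at-offsets-+ k κ t′) order≡

  Distinct : ∀ {n} → Vec Carrier n → Set ℓ
  Distinct ys = ∀ i j → i ≢ j → ¬ lookup ys i ≈ lookup ys j

  expand-node-distinct : ∀ {n} (ys : Vec Carrier n) κ → Distinct ys → ∀ p t → p ℕ.< sum κ →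
    t ℕ.< p ℕ.∸ at (offsets κ) p 0 → ¬ at (expand R ys κ) t 0# ≈ at (expand R ys κ) p 0#
  expand-node-distinct (y ∷ ys) (k ∷ κ) distinct p t p<N t<p∸o with split< k (sum κ) p p<N
  ... | inj₁ p<k =
    ⊥-elim (ℕₚ.n≮0 (≡.subst (t ℕ.<_) (≡.trans (≡.cong (p ℕ.∸_) (at-offsets-< k κ p p<k)) (ℕₚ.n∸n≡0 p)) t<p∸o))
  ... | inj₂ (p′ , ≡.refl , p′<N) with split< k (p′ ℕ.∸ at (offsets κ) p′ 0) t t<k+[p′∸o]
    where
    t<k+[p′∸o] : t ℕ.< k ℕ.+ (p′ ℕ.∸ at (offsets κ) p′ 0)
    t<k+[p′∸o] = ≡.subst (t ℕ.<_) (ℕₚ.+-∸-assoc k (at-offsets≤ κ p′ p′<N))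
                   (≡.subst (λ o → t ℕ.< k ℕ.+ p′ ℕ.∸ o) (at-offsets-+ k κ p′) t<p∸o)
  ...   | inj₁ t<k with at-expand-lookup ys κ p′ p′<N
  ...     | q , node≡ = λ t≈p → distinct zero (suc q) (λ ()) (begin
    y                                         ≡⟨ at-expand-< y ys k κ t 0# t<k ⟨
    at (expand R (y ∷ ys) (k ∷ κ)) t 0#        ≈⟨ t≈p ⟩
    at (expand R (y ∷ ys) (k ∷ κ)) (k ℕ.+ p′) 0# ≡⟨ ≡.trans (at-expand-+ y ys k κ p′ 0#) node≡ ⟩
    lookup ys q                               ∎)
  expand-node-distinct (y ∷ ys) (k ∷ κ) distinct _ t _ _ | inj₂ (p′ , ≡.refl , p′<N) | inj₂ (t′ , ≡.refl , t′<p′∸o) =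
    λ t≈p → expand-node-distinct ys κ (λ i j i≢j → distinct (suc i) (suc j) (i≢j ∘ Finₚ.suc-injective))
                                 p′ t′ p′<N t′<p′∸o
      (≡.subst₂ _≈_ (at-expand-+ y ys k κ t′ 0#) (at-expand-+ y ys k κ p′ 0#) t≈p)

  expandedColumns : ∀ {n} (ys : Vec Carrier n) κ → Distinct ys → ConfluentColumns R (sum κ)
  expandedColumns ys κ distinct = record
    { node          = λ t → at (expand R ys κ) t 0#
    ; order         = λ t → at (offsets κ) t 0
    ; order≤index   = at-offsets≤ κ
    ; order-suc     = expand-order-suc ys κ
    ; node-distinct = expand-node-distinct ys κ distinct
    }

  at-Gcols : ∀ {n} N lam (ys : Vec Carrier n) κ t d j → t ℕ.< sum κ →
    at (Gcols R N lam ys κ) t d j ≡ Gentry R N lam (at (expand R ys κ) t 0#) (at (offsets κ) t 0) (toℕ j)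
  at-Gcols N lam (y ∷ ys) (k ∷ κ) t d j t<N with split< k (sum κ) t t<N
  ... | inj₁ t<k = ≡.trans
    (≡.cong (λ column → column j)
      (≡.trans (at-++ˡ (tabulate {n = k} λ r j → Gentry R N lam y (toℕ r) (toℕ j)) (Gcols R N lam ys κ) t d t<k)
               (at-tabulate k (λ r j → Gentry R N lam y (toℕ r) (toℕ j)) t d t<k)))
    (≡.cong₂ (λ ζ r → Gentry R N lam ζ r (toℕ j))
      (≡.sym (at-expand-< y ys k κ t 0# t<k))
      (≡.trans (Finₚ.toℕ-fromℕ< t<k) (≡.sym (at-offsets-< k κ t t<k))))
  ... | inj₂ (t′ , ≡.refl , t′<N) = ≡.trans
    (≡.cong (λ column → column j)
      (at-++ʳ (tabulate {n = k} λ r j → Gentry R N lam y (toℕ r) (toℕ j)) (Gcols R N lam ys κ) t′ d))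
    (≡.trans (at-Gcols N lam ys κ t′ d j t′<N)
      (≡.cong₂ (λ ζ r → Gentry R N lam ζ r (toℕ j))
        (≡.sym (at-expand-+ y ys k κ t′ 0#)) (≡.sym (at-offsets-+ k κ t′))))

  G≡confluentMatrix : ∀ {n} lam (ys : Vec Carrier n) κ (distinct : Distinct ys) j p →
    G R lam ys κ j p ≡ confluentMatrix (expandedColumns ys κ distinct) lam j p
  G≡confluentMatrix lam ys κ distinct j p = ≡.trans
    (≡.cong (λ column → column j) (lookup≡at (Gcols R (sum κ) lam ys κ) p (λ _ → 0#)))
    (at-Gcols (sum κ) lam ys κ (toℕ p) (λ _ → 0#) j (Finₚ.toℕ<n p))

  det-G≈det-confluentMatrix : ∀ {n} lam (ys : Vec Carrier n) κ (distinct : Distinct ys) →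
    det R (sum κ) (G R lam ys κ) ≈ det R (sum κ) (confluentMatrix (expandedColumns ys κ distinct) lam)
  det-G≈det-confluentMatrix lam ys κ distinct =
    det-cong (sum κ) (λ j p → reflexive (G≡confluentMatrix lam ys κ distinct j p))

corollary1p2 : ∀ {c ℓ} (F : Field c ℓ) → let open Field F in
    (n : ℕ) → 1 ≤ n → (κ : Vec ℕ n) → (∀ i → 1 ≤ lookup κ i) → (m : ℕ) →
    (y : Vec Carrier n) → (∀ i j → i ≢ j → ¬ (lookup y i ≈ lookup y j)) →
    Σ (¬ (det commutativeRing (sum κ) (G commutativeRing emptyPart y κ) ≈ 0#)) λ nz →
      hcomplete commutativeRing m (expand commutativeRing y κ)
        ≈ det commutativeRing (sum κ) (G commutativeRing (onePart m) y κ)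
          * inverse (det commutativeRing (sum κ) (G commutativeRing emptyPart y κ)) nz
corollary1p2 F (suc n) _ κ@(k ∷ _) κ-positive m y distinct = G∅≉0 , x*d≈y⇒x≈y*d⁻¹ G∅≉0 h*G∅≈Gₘ
  where
  open Field F hiding (zero)
  open FieldDeterminant F
  open import Relation.Binary.Reasoning.Setoid setoid

  R : CommutativeRing _ _
  R = commutativeRing

  open ExpandedColumns R

  N≥1 : 1 ≤ sum κ
  N≥1 = ℕₚ.≤-trans (κ-positive zero) (ℕₚ.m≤m+n k _)

  cols : ConfluentColumns R (sum κ)
  cols = expandedColumns y κ distinct

  G∅≉0 : ¬ det R (sum κ) (G R emptyPart y κ) ≈ 0#
  G∅≉0 = det-confluentMatrix-emptyPart-nonzero F (sum κ) N≥1 cols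
       ∘ trans (sym (det-G≈det-confluentMatrix emptyPart y κ distinct))

  h*G∅≈Gₘ : hcomplete R m (expand R y κ) * det R (sum κ) (G R emptyPart y κ) ≈ det R (sum κ) (G R (onePart m) y κ)
  h*G∅≈Gₘ = begin
    hcomplete R m (expand R y κ) * det R (sum κ) (G R emptyPart y κ)
      ≈⟨ *-congˡ (det-G≈det-confluentMatrix emptyPart y κ distinct) ⟩
    hcomplete R m (expand R y κ) * det R (sum κ) (confluentMatrix cols emptyPart)
      ≈⟨ hcomplete*det-confluentMatrix R (sum κ) N≥1 cols m (expand R y κ) (λ _ _ → ≡.refl) ⟩
    det R (sum κ) (confluentMatrix cols (onePart m))
      ≈⟨ det-G≈det-confluentMatrix (onePart m) y κ distinct ⟨
    det R (sum κ) (G R (onePart m) y κ) ∎
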